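{- Let $n,t,s$ be positive integers with $n\geq 5s(t+1)^{2}$. Suppose that $\mathcal{F},\mathcal{G}\subseteq\binom{[n]}{t+1}$ are $s$-almost cross-$t$-intersecting but not cross-$t$-intersecting families with $|\mathcal{F}|\leq|\mathcal{G}|$, and that $|\mathcal{F}||\mathcal{G}|$ is maximum among all such pairs. (i) If $t\geq s+2$, then there exists $Y\in\binom{[n]}{t+1}$ such that $\mathcal{F}=\{Y\}$ and $\mathcal{G}=\mathcal{M}_1(Y;t+1,t)\cup\mathcal{C}$, where $\mathcal{C}$ is an $s$-subset of $\binom{[n]}{t+1}\setminus\mathcal{M}_1(Y;t+1,t)$. (ii) If $t\leq s+1$, then there exist $Z\in\binom{[n]}{t+s+2}$ and $W\in\binom{Z}{t}$ such that $\mathcal{F}=\mathcal{H}_1(Z,W;t+1)$ and $\mathcal{G}=\mathcal{H}_1([n],W;t+1)\cup\mathcal{D}$, where $\mathcal{D}$ is an $(s+2)$-subset of $\mathcal{M}_2(Z,W;t)$ such that each element of $Z\setminus W$ is contained in exactly two members of $\mathcal{D}$.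
   Context: $[n]=\{1,\dots,n\}$ and $\binom{X}{k}$ denotes the family of all $k$-subsets of a set $X$. Two sets $F,G$ are $t$-intersecting if $|F\cap G|\geq t$ and $t$-disjoint otherwise. Families $\mathcal{F},\mathcal{G}$ are cross-$t$-intersecting if every member of $\mathcal{F}$ and every member of $\mathcal{G}$ are $t$-intersecting; they are $s$-almost cross-$t$-intersecting if each member of $\mathcal{F}$ is $t$-disjoint with at most $s$ members of $\mathcal{G}$ and each member of $\mathcal{G}$ is $t$-disjoint with at most $s$ members of $\mathcal{F}$. For subsets $W\subseteq X$ and $Y$ of $[n]$: $\mathcal{H}_1(X,W;k)=\{F\in\binom{X}{k}: W\subseteq F\}$, $\mathcal{M}_1(Y;k,t)=\{F\in\binom{[n]}{k}: |F\cap Y|\geq t\}$, and $\mathcal{M}_2(X,W;t)=\{F\in\binom{X}{t+1}: |F\cap W|=t-1\}$. -}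

module Defs where

open import Data.Nat using (ℕ; _+_; _∸_; _≤_; _<_; _<?_)
open import Data.Fin using (Fin)
open import Data.Fin.Subset using (Subset; _∩_; _⊆_; ∣_∣; ⊤) renaming (_∈_ to _∈ˢ_)
open import Data.Fin.Subset.Properties using (_∈?_)
open import Data.List using (List; length; filter)
open import Data.List.Relation.Unary.All using (All)
open import Data.List.Relation.Unary.Unique.Propositional using (Unique)
open import Data.List.Membership.Propositional using (_∈_)
open import Data.Product using (_×_)
open import Relation.Nullary using (¬_)

Family : ℕ → Set
Family n = List (Subset n)

IsFamily : ∀ {n} → ℕ → Family n → Set
IsFamily k 𝓕 = Unique 𝓕 × All (λ X → ∣ X ∣ ≡ k) 𝓕
  where open import Relation.Binary.PropositionalEquality using (_≡_)

numTDisjoint : ∀ {n} → ℕ → Subset n → Family n → ℕ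
numTDisjoint t A 𝓖 = length (filter (λ B → ∣ A ∩ B ∣ <? t) 𝓖)

CrossTIntersecting : ∀ {n} → ℕ → Family n → Family n → Set
CrossTIntersecting t 𝓕 𝓖 = All (λ A → All (λ B → t ≤ ∣ A ∩ B ∣) 𝓖) 𝓕

AlmostCrossTIntersecting : ∀ {n} → ℕ → ℕ → Family n → Family n → Set
AlmostCrossTIntersecting s t 𝓕 𝓖 =
  All (λ A → numTDisjoint t A 𝓖 ≤ s) 𝓕 × All (λ B → numTDisjoint t B 𝓕 ≤ s) 𝓖

Admissible : ∀ n → ℕ → ℕ → Family n → Family n → Set
Admissible n t s 𝓕 𝓖 =
  IsFamily (t + 1) 𝓕 × IsFamily (t + 1) 𝓖 ×
  AlmostCrossTIntersecting s t 𝓕 𝓖 × ¬ CrossTIntersecting t 𝓕 𝓖 ×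
  length 𝓕 ≤ length 𝓖

H₁ : ∀ {n} → Subset n → Subset n → ℕ → Subset n → Set
H₁ X W k F = F ⊆ X × W ⊆ F × ∣ F ∣ ≡ k
  where open import Relation.Binary.PropositionalEquality using (_≡_)

M₁ : ∀ {n} → Subset n → ℕ → ℕ → Subset n → Set
M₁ Y k t F = ∣ F ∣ ≡ k × t ≤ ∣ F ∩ Y ∣
  where open import Relation.Binary.PropositionalEquality using (_≡_)

M₂ : ∀ {n} → Subset n → Subset n → ℕ → Subset n → Set
M₂ X W t F = F ⊆ X × ∣ F ∣ ≡ t + 1 × ∣ F ∩ W ∣ ≡ t ∸ 1
  where open import Relation.Binary.PropositionalEquality using (_≡_)

numContaining : ∀ {n} → Fin n → Family n → ℕ
numContaining i 𝓓 = length (filter (λ X → i ∈? X) 𝓓)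

-- Write 𝓖_W for the members of 𝓖 containing a t-set W.  If 𝓕 = {Y}, all but s members of 𝓖
-- t-intersect Y, so |𝓖| ≤ L₁ = 1 + (t + 1)(n − t − 1) + s, the product of configuration (i).
-- If |𝓕| ≥ 2, then either two members of 𝓕 fail to t-intersect, or 𝓕 is pairwise t-intersecting
-- but not a star and then 𝓕 and most of 𝓖 live inside a (t + 2)-set, or 𝓕 is a star {W ∪ {x}}.
-- In the first two cases |𝓕||𝓖| is polynomial in t and s.  In the star case |𝓖_W| ≤ n − t, and a
-- member of 𝓖 − 𝓖_W t-intersects at most two members of 𝓕, so double counting the t-disjoint pairs
-- gives |𝓖 − 𝓖_W| (|𝓕| − 2) ≤ |𝓕| s.  For n ≥ 5 s (t + 1)² all of this stays below
-- L₂ = (s + 2)(n − t + s + 2), the product of configuration (ii), unless |𝓕| = s + 2 and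
-- |𝓖 − 𝓖_W| ≤ s + 2.  Since L₁ > L₂ exactly when t ≥ s + 2, a maximal pair has the shape of
-- configuration (i) or (ii); maximality then puts into 𝓖 every (t + 1)-set t-intersecting all of 𝓕
-- and makes the double count tight, which pins down the structure.

{-# OPTIONS --safe #-}
module Submission where

open import Defs
open import Algebra.Solver.IdempotentCommutativeMonoid as ∪-Solver using ()
open import Data.Nat using (ℕ; zero; suc; _≟_; _+_; _*_; _∸_; _^_; _≤_; _<_; z≤n; s≤s; _≤?_; _<?_; >-nonZero)
open import Data.Nat.Properties
open import Data.Nat.ListAction using (sum)
open import Data.Nat.Tactic.RingSolver using (solve-∀)
open import Data.Bool using (true; false; if_then_else_)
import Data.Bool.Properties as Bool
open import Data.Fin using (Fin; zero; suc; toℕ; fromℕ<)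
import Data.Fin as Fin
open import Data.Fin.Properties using (toℕ-fromℕ<) renaming (suc-injective to Fin-suc-injective)
open import Data.Vec using ([]; _∷_; here; there)
open import Data.Vec.Properties using (≡-dec)
open import Data.Fin.Subset
open import Data.Fin.Subset.Properties
open import Data.List using (List; []; _∷_; length; filter; map; _++_; cartesianProduct; upTo)
open import Data.List.Properties using (length-map; length-++; length-filter; filter-++; filter-none; filter-reject; filter-≐; length-applyUpTo; map-cong)
open import Data.List.Relation.Unary.Any using (here; there)
import Data.List.Relation.Unary.All as All
open import Data.List.Relation.Unary.All using (All; []; _∷_; all?) renaming (lookup to all-lookup; head to all-head)
open import Data.List.Relation.Unary.All.Properties using (¬All⇒Any¬; ¬Any⇒All¬)
open import Data.List.Relation.Unary.AllPairs using ([]; _∷_)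
open import Data.List.Relation.Unary.Unique.Propositional using (Unique)
import Data.List.Relation.Unary.Unique.Propositional.Properties as UP
import Data.List.Membership.DecPropositional as DecMembership
open import Data.List.Membership.Propositional using (find) renaming (_∈_ to _∈ᶠ_; _∉_ to _∉ᶠ_)
open import Data.List.Membership.Propositional.Properties
  using (∈-filter⁺; ∈-filter⁻; ∈-map⁺; ∈-map⁻; ∈-upTo⁺; ∈-upTo⁻; ∈-++⁻; ∈-++⁺ʳ; ∈-cartesianProduct⁺; ∈-cartesianProduct⁻)
open import Data.Product using (_×_; _,_; ∃-syntax; proj₁; proj₂)
open import Data.Sum using (_⊎_; inj₁; inj₂; [_,_]′) renaming (map to ⊎-map)
open import Data.Empty using (⊥-elim)
open import Function using (_∘_)
open import Function.Bundles using (_⇔_; mk⇔)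
open import Relation.Nullary using (¬_; yes; no; does; Dec; ¬?)
open import Relation.Unary using (Decidable)
open import Relation.Binary.PropositionalEquality

private variable n : ℕ

-- Cardinalities of subsets of Fin n

∣p∩q∣+∣p∪q∣≡∣p∣+∣q∣ : (p q : Subset n) → ∣ p ∩ q ∣ + ∣ p ∪ q ∣ ≡ ∣ p ∣ + ∣ q ∣
∣p∩q∣+∣p∪q∣≡∣p∣+∣q∣ [] [] = refl
∣p∩q∣+∣p∪q∣≡∣p∣+∣q∣ (true ∷ p) (true ∷ q) =
  cong suc (trans (+-suc _ _) (trans (cong suc (∣p∩q∣+∣p∪q∣≡∣p∣+∣q∣ p q)) (sym (+-suc _ _))))
∣p∩q∣+∣p∪q∣≡∣p∣+∣q∣ (true ∷ p) (false ∷ q) = trans (+-suc _ _) (cong suc (∣p∩q∣+∣p∪q∣≡∣p∣+∣q∣ p q))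
∣p∩q∣+∣p∪q∣≡∣p∣+∣q∣ (false ∷ p) (true ∷ q) =
  trans (+-suc _ _) (trans (cong suc (∣p∩q∣+∣p∪q∣≡∣p∣+∣q∣ p q)) (sym (+-suc _ _)))
∣p∩q∣+∣p∪q∣≡∣p∣+∣q∣ (false ∷ p) (false ∷ q) = ∣p∩q∣+∣p∪q∣≡∣p∣+∣q∣ p q

∣p∩q∣+∣p─q∣≡∣p∣ : (p q : Subset n) → ∣ p ∩ q ∣ + ∣ p ─ q ∣ ≡ ∣ p ∣
∣p∩q∣+∣p─q∣≡∣p∣ [] [] = refl
∣p∩q∣+∣p─q∣≡∣p∣ (true ∷ p) (true ∷ q) = cong suc (∣p∩q∣+∣p─q∣≡∣p∣ p q)
∣p∩q∣+∣p─q∣≡∣p∣ (true ∷ p) (false ∷ q) = trans (+-suc _ _) (cong suc (∣p∩q∣+∣p─q∣≡∣p∣ p q))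
∣p∩q∣+∣p─q∣≡∣p∣ (false ∷ p) (true ∷ q) = ∣p∩q∣+∣p─q∣≡∣p∣ p q
∣p∩q∣+∣p─q∣≡∣p∣ (false ∷ p) (false ∷ q) = ∣p∩q∣+∣p─q∣≡∣p∣ p q

p⊆q∧∣q∣≤∣p∣⇒p≡q : (p q : Subset n) → p ⊆ q → ∣ q ∣ ≤ ∣ p ∣ → p ≡ q
p⊆q∧∣q∣≤∣p∣⇒p≡q [] [] _ _ = refl
p⊆q∧∣q∣≤∣p∣⇒p≡q (true ∷ p) (true ∷ q) p⊆q le = cong (true ∷_) (p⊆q∧∣q∣≤∣p∣⇒p≡q p q (drop-∷-⊆ p⊆q) (≤-pred le))
p⊆q∧∣q∣≤∣p∣⇒p≡q (true ∷ p) (false ∷ q) p⊆q le with () ← p⊆q here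
p⊆q∧∣q∣≤∣p∣⇒p≡q (false ∷ p) (true ∷ q) p⊆q le = ⊥-elim (≤⇒≯ le (s≤s (p⊆q⇒∣p∣≤∣q∣ (drop-∷-⊆ p⊆q))))
p⊆q∧∣q∣≤∣p∣⇒p≡q (false ∷ p) (false ∷ q) p⊆q le = cong (false ∷_) (p⊆q∧∣q∣≤∣p∣⇒p≡q p q (drop-∷-⊆ p⊆q) le)

0<∣p∣⇒Nonempty : (p : Subset n) → 0 < ∣ p ∣ → Nonempty p
0<∣p∣⇒Nonempty (true ∷ p) _ = zero , here
0<∣p∣⇒Nonempty (false ∷ p) h with x , x∈p ← 0<∣p∣⇒Nonempty p h = suc x , there x∈p

x∈p⇒0<∣p∣ : (p : Subset n) {x : Fin n} → x ∈ p → 0 < ∣ p ∣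
x∈p⇒0<∣p∣ (true ∷ p) _ = s≤s z≤n
x∈p⇒0<∣p∣ (false ∷ p) (there x∈p) = x∈p⇒0<∣p∣ p x∈p

∣p∣≤1⇒x≡y : (p : Subset n) → ∣ p ∣ ≤ 1 → ∀ {x y} → x ∈ p → y ∈ p → x ≡ y
∣p∣≤1⇒x≡y (true ∷ p) h here here = refl
∣p∣≤1⇒x≡y (true ∷ p) h here (there y∈p) = ⊥-elim (≤⇒≯ h (s≤s (x∈p⇒0<∣p∣ p y∈p)))
∣p∣≤1⇒x≡y (true ∷ p) h (there x∈p) here = ⊥-elim (≤⇒≯ h (s≤s (x∈p⇒0<∣p∣ p x∈p)))
∣p∣≤1⇒x≡y (true ∷ p) h (there x∈p) (there y∈p) = cong suc (∣p∣≤1⇒x≡y p (≤-trans (n≤1+n _) h) x∈p y∈p)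
∣p∣≤1⇒x≡y (false ∷ p) h (there x∈p) (there y∈p) = cong suc (∣p∣≤1⇒x≡y p h x∈p y∈p)

x∈p⇒suc∣p-x∣≡∣p∣ : (p : Subset n) {x : Fin n} → x ∈ p → suc ∣ p - x ∣ ≡ ∣ p ∣
x∈p⇒suc∣p-x∣≡∣p∣ (true ∷ p) here = cong (λ q → suc ∣ q ∣) (p─⊥≡p p)
x∈p⇒suc∣p-x∣≡∣p∣ (true ∷ p) (there x∈p) = cong suc (x∈p⇒suc∣p-x∣≡∣p∣ p x∈p)
x∈p⇒suc∣p-x∣≡∣p∣ (false ∷ p) (there x∈p) = x∈p⇒suc∣p-x∣≡∣p∣ p x∈p

x∉p⇒∣⁅x⁆∪p∣≡suc∣p∣ : (p : Subset n) {x : Fin n} → x ∉ p → ∣ ⁅ x ⁆ ∪ p ∣ ≡ suc ∣ p ∣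
x∉p⇒∣⁅x⁆∪p∣≡suc∣p∣ (true ∷ p) {zero} x∉p = ⊥-elim (x∉p here)
x∉p⇒∣⁅x⁆∪p∣≡suc∣p∣ (false ∷ p) {zero} x∉p = cong (suc ∘ ∣_∣) (∪-identityˡ p)
x∉p⇒∣⁅x⁆∪p∣≡suc∣p∣ (true ∷ p) {suc x} x∉p = cong suc (x∉p⇒∣⁅x⁆∪p∣≡suc∣p∣ p (x∉p ∘ there))
x∉p⇒∣⁅x⁆∪p∣≡suc∣p∣ (false ∷ p) {suc x} x∉p = x∉p⇒∣⁅x⁆∪p∣≡suc∣p∣ p (x∉p ∘ there)

∣p∣≤∣p∩q∣⇒p⊆q : (p q : Subset n) → ∣ p ∣ ≤ ∣ p ∩ q ∣ → p ⊆ q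
∣p∣≤∣p∩q∣⇒p⊆q p q le {x} x∈p =
  p∩q⊆q p q (subst (x ∈_) (sym (p⊆q∧∣q∣≤∣p∣⇒p≡q (p ∩ q) p (p∩q⊆p p q) le)) x∈p)

p⊈q⇒∣p∩q∣<∣p∣ : (p q : Subset n) → ¬ (p ⊆ q) → ∣ p ∩ q ∣ < ∣ p ∣
p⊈q⇒∣p∩q∣<∣p∣ p q p⊈q = ≰⇒> (p⊈q ∘ ∣p∣≤∣p∩q∣⇒p⊆q p q)

q⊆p⇒∣p∩q∣≡∣q∣ : (p q : Subset n) → q ⊆ p → ∣ p ∩ q ∣ ≡ ∣ q ∣
q⊆p⇒∣p∩q∣≡∣q∣ p q q⊆p = ≤-antisym (∣p∩q∣≤∣q∣ p q) (p⊆q⇒∣p∣≤∣q∣ (λ x∈q → x∈p∩q⁺ (q⊆p x∈q , x∈q)))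

distinct⇒∣p∩q∣<∣p∣ : (p q : Subset n) → ∣ p ∣ ≡ ∣ q ∣ → p ≢ q → ∣ p ∩ q ∣ < ∣ p ∣
distinct⇒∣p∩q∣<∣p∣ p q eq p≢q =
  p⊈q⇒∣p∩q∣<∣p∣ p q (λ p⊆q → p≢q (p⊆q∧∣q∣≤∣p∣⇒p≡q p q p⊆q (≤-reflexive (sym eq))))

∈∩⁺ : {p q : Subset n} {x : Fin n} → x ∈ p → x ∈ q → x ∈ p ∩ q
∈∩⁺ x∈p x∈q = x∈p∩q⁺ (x∈p , x∈q)

x∈p─q⇒x∉q : (p q : Subset n) {x : Fin n} → x ∈ p ─ q → x ∉ q
x∈p─q⇒x∉q (b ∷ p) (true ∷ q) {zero} () here
x∈p─q⇒x∉q (true ∷ p) (false ∷ q) {zero} _ ()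
x∈p─q⇒x∉q (b ∷ p) (c ∷ q) {suc x} (there x∈p─q) (there x∈q) = x∈p─q⇒x∉q p q x∈p─q x∈q

∈⁅x⁆∪p⁻ : {x y : Fin n} {p : Subset n} → y ∈ ⁅ x ⁆ ∪ p → y ≡ x ⊎ y ∈ p
∈⁅x⁆∪p⁻ {x = x} {p = p} y∈ with x∈p∪q⁻ ⁅ x ⁆ p y∈
... | inj₁ y∈⁅x⁆ = inj₁ (x∈⁅y⁆⇒x≡y x y∈⁅x⁆)
... | inj₂ y∈p = inj₂ y∈p

x∈⁅x⁆∪p : (x : Fin n) (p : Subset n) → x ∈ ⁅ x ⁆ ∪ p
x∈⁅x⁆∪p x p = x∈p∪q⁺ (inj₁ (x∈⁅x⁆ x))

p⊆⁅x⁆∪p : (x : Fin n) (p : Subset n) → p ⊆ ⁅ x ⁆ ∪ p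
p⊆⁅x⁆∪p x p x∈p = x∈p∪q⁺ (inj₂ x∈p)

⁅x⁆∪p⊆q : {p q : Subset n} {x : Fin n} → x ∈ q → p ⊆ q → ⁅ x ⁆ ∪ p ⊆ q
⁅x⁆∪p⊆q x∈q p⊆q y∈ with ∈⁅x⁆∪p⁻ y∈
... | inj₁ refl = x∈q
... | inj₂ y∈p = p⊆q y∈p

x∉p-x : (p : Subset n) (x : Fin n) → x ∉ p - x
x∉p-x p x x∈ = x∈p─q⇒x∉q p ⁅ x ⁆ x∈ (x∈⁅x⁆ x)

p-x⊆p : (p : Subset n) (x : Fin n) → p - x ⊆ p
p-x⊆p p x = p─q⊆p p ⁅ x ⁆

-- One-point extensions: W ⊆ A with ∣ A ∣ ≡ suc ∣ W ∣

extension-∣─∣≡1 : (W A : Subset n) → W ⊆ A → ∣ A ∣ ≡ suc ∣ W ∣ → ∣ A ─ W ∣ ≡ 1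
extension-∣─∣≡1 W A W⊆A eA = +-cancelˡ-≡ ∣ W ∣ _ _ (begin
  ∣ W ∣ + ∣ A ─ W ∣      ≡⟨ cong (_+ ∣ A ─ W ∣) (q⊆p⇒∣p∩q∣≡∣q∣ A W W⊆A) ⟨
  ∣ A ∩ W ∣ + ∣ A ─ W ∣  ≡⟨ ∣p∩q∣+∣p─q∣≡∣p∣ A W ⟩
  ∣ A ∣                  ≡⟨ trans eA (+-comm 1 ∣ W ∣) ⟩
  ∣ W ∣ + 1              ∎)
  where open ≡-Reasoning

extension-new-point : (W A : Subset n) → W ⊆ A → ∣ A ∣ ≡ suc ∣ W ∣ → ∃[ x ] (x ∈ A × x ∉ W)
extension-new-point W A W⊆A eA
  with x , x∈ ← 0<∣p∣⇒Nonempty (A ─ W) (subst (0 <_) (sym (extension-∣─∣≡1 W A W⊆A eA)) (s≤s z≤n))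
  = x , p─q⊆p A W x∈ , x∈p─q⇒x∉q A W x∈

extension-unique-new-point : (W A : Subset n) → W ⊆ A → ∣ A ∣ ≡ suc ∣ W ∣ →
  ∀ {x y} → x ∈ A → x ∉ W → y ∈ A → y ∉ W → x ≡ y
extension-unique-new-point W A W⊆A eA x∈A x∉W y∈A y∉W =
  ∣p∣≤1⇒x≡y (A ─ W) (≤-reflexive (extension-∣─∣≡1 W A W⊆A eA))
    (x∈p∧x∉q⇒x∈p─q x∈A x∉W) (x∈p∧x∉q⇒x∈p─q y∈A y∉W)

extension-injective : (W A A′ : Subset n) {x : Fin n} → W ⊆ A → W ⊆ A′ →
  ∣ A ∣ ≡ suc ∣ W ∣ → ∣ A′ ∣ ≡ suc ∣ W ∣ → x ∈ A → x ∈ A′ → x ∉ W → A ≡ A′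
extension-injective W A A′ W⊆A W⊆A′ eA eA′ x∈A x∈A′ x∉W =
  p⊆q∧∣q∣≤∣p∣⇒p≡q A A′ (∣p∣≤∣p∩q∣⇒p⊆q A A′ A≤A∩A′) (≤-reflexive (trans eA′ (sym eA)))
  where
  A≤A∩A′ : ∣ A ∣ ≤ ∣ A ∩ A′ ∣
  A≤A∩A′ = subst (_≤ ∣ A ∩ A′ ∣) (trans (x∉p⇒∣⁅x⁆∪p∣≡suc∣p∣ W x∉W) (sym eA))
    (p⊆q⇒∣p∣≤∣q∣ (λ y∈ → ∈∩⁺ (⁅x⁆∪p⊆q x∈A W⊆A y∈) (⁅x⁆∪p⊆q x∈A′ W⊆A′ y∈)))

∣∩extension∣-new∈ : (W A B : Subset n) {x : Fin n} → W ⊆ A → ∣ A ∣ ≡ suc ∣ W ∣ →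
  x ∈ A → x ∉ W → x ∈ B → ∣ B ∩ A ∣ ≡ suc ∣ B ∩ W ∣
∣∩extension∣-new∈ W A B {x} W⊆A eA x∈A x∉W x∈B = ≤-antisym
  (subst (∣ B ∩ A ∣ ≤_) (x∉p⇒∣⁅x⁆∪p∣≡suc∣p∣ (B ∩ W) x∉B∩W) (p⊆q⇒∣p∣≤∣q∣ B∩A⊆))
  (subst (_≤ ∣ B ∩ A ∣) (x∉p⇒∣⁅x⁆∪p∣≡suc∣p∣ (B ∩ W) x∉B∩W)
    (p⊆q⇒∣p∣≤∣q∣ (⁅x⁆∪p⊆q (∈∩⁺ x∈B x∈A) (λ y∈ → ∈∩⁺ (p∩q⊆p B W y∈) (W⊆A (p∩q⊆q B W y∈))))))
  where
  x∉B∩W : x ∉ B ∩ W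
  x∉B∩W = x∉W ∘ p∩q⊆q B W
  B∩A⊆ : B ∩ A ⊆ ⁅ x ⁆ ∪ (B ∩ W)
  B∩A⊆ {y} y∈ with y ∈? W
  ... | yes y∈W = p⊆⁅x⁆∪p x (B ∩ W) (∈∩⁺ (p∩q⊆p B A y∈) y∈W)
  ... | no y∉W rewrite extension-unique-new-point W A W⊆A eA (p∩q⊆q B A y∈) y∉W x∈A x∉W = x∈⁅x⁆∪p x (B ∩ W)

∣∩extension∣-new∉ : (W A B : Subset n) {x : Fin n} → W ⊆ A → ∣ A ∣ ≡ suc ∣ W ∣ →
  x ∈ A → x ∉ W → x ∉ B → ∣ B ∩ A ∣ ≡ ∣ B ∩ W ∣
∣∩extension∣-new∉ W A B {x} W⊆A eA x∈A x∉W x∉B = ≤-antisym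
  (p⊆q⇒∣p∣≤∣q∣ B∩A⊆B∩W) (p⊆q⇒∣p∣≤∣q∣ (λ y∈ → ∈∩⁺ (p∩q⊆p B W y∈) (W⊆A (p∩q⊆q B W y∈))))
  where
  B∩A⊆B∩W : B ∩ A ⊆ B ∩ W
  B∩A⊆B∩W {y} y∈ with y ∈? W
  ... | yes y∈W = ∈∩⁺ (p∩q⊆p B A y∈) y∈W
  ... | no y∉W = ⊥-elim (x∉B (subst (_∈ B)
          (extension-unique-new-point W A W⊆A eA (p∩q⊆q B A y∈) y∉W x∈A x∉W) (p∩q⊆p B A y∈)))

∣∩extension∣≤ : (W A B : Subset n) → W ⊆ A → ∣ A ∣ ≡ suc ∣ W ∣ → ∣ B ∩ A ∣ ≤ suc ∣ B ∩ W ∣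
∣∩extension∣≤ W A B W⊆A eA with x , x∈A , x∉W ← extension-new-point W A W⊆A eA | x ∈? B
... | yes x∈B = ≤-reflexive (∣∩extension∣-new∈ W A B W⊆A eA x∈A x∉W x∈B)
... | no x∉B = ≤-trans (≤-reflexive (∣∩extension∣-new∉ W A B W⊆A eA x∈A x∉W x∉B)) (n≤1+n _)

module _ (A₁ A₂ B : Subset n) (t : ℕ) where

  private
    t+t≤∣∩∣+∣∪∣ : t ≤ ∣ B ∩ A₁ ∣ → t ≤ ∣ B ∩ A₂ ∣ →
      t + t ≤ ∣ (B ∩ A₁) ∩ (B ∩ A₂) ∣ + ∣ (B ∩ A₁) ∪ (B ∩ A₂) ∣
    t+t≤∣∩∣+∣∪∣ h₁ h₂ = subst (t + t ≤_) (sym (∣p∩q∣+∣p∪q∣≡∣p∣+∣q∣ (B ∩ A₁) (B ∩ A₂))) (+-mono-≤ h₁ h₂)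

    ∩⊆ : (B ∩ A₁) ∩ (B ∩ A₂) ⊆ B ∩ (A₁ ∩ A₂)
    ∩⊆ x∈ with x∈p∩q⁻ _ _ x∈
    ... | x∈₁ , x∈₂ = ∈∩⁺ (p∩q⊆p B A₁ x∈₁) (∈∩⁺ (p∩q⊆q B A₁ x∈₁) (p∩q⊆q B A₂ x∈₂))

    ∪⊆ : (B ∩ A₁) ∪ (B ∩ A₂) ⊆ B ∩ (A₁ ∪ A₂)
    ∪⊆ x∈ with x∈p∪q⁻ (B ∩ A₁) (B ∩ A₂) x∈
    ... | inj₁ x∈₁ = ∈∩⁺ (p∩q⊆p B A₁ x∈₁) (p⊆p∪q A₂ (p∩q⊆q B A₁ x∈₁))
    ... | inj₂ x∈₂ = ∈∩⁺ (p∩q⊆p B A₂ x∈₂) (q⊆p∪q A₁ A₂ (p∩q⊆q B A₂ x∈₂))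

  meets-both⇒⊆∪ : ∣ B ∣ ≡ suc t → t ≤ ∣ B ∩ A₁ ∣ → t ≤ ∣ B ∩ A₂ ∣ →
    ∣ B ∩ (A₁ ∩ A₂) ∣ < t → B ⊆ A₁ ∪ A₂
  meets-both⇒⊆∪ eB h₁ h₂ small = ∣p∣≤∣p∩q∣⇒p⊆q B (A₁ ∪ A₂)
    (subst (_≤ ∣ B ∩ (A₁ ∪ A₂) ∣) (sym eB) (≤-trans t<∪ (p⊆q⇒∣p∣≤∣q∣ ∪⊆)))
    where
    ∩<t : ∣ (B ∩ A₁) ∩ (B ∩ A₂) ∣ < t
    ∩<t = ≤-<-trans (p⊆q⇒∣p∣≤∣q∣ ∩⊆) small
    t<∪ : t < ∣ (B ∩ A₁) ∪ (B ∩ A₂) ∣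
    t<∪ = +-cancelˡ-≤ _ _ _ (≤-trans (subst (_≤ t + t) (sym (+-suc _ t)) (+-monoˡ-≤ t ∩<t)) (t+t≤∣∩∣+∣∪∣ h₁ h₂))

  meets-both⇒t≤suc∣∩∣ : ∣ B ∣ ≡ suc t → t ≤ ∣ B ∩ A₁ ∣ → t ≤ ∣ B ∩ A₂ ∣ → t ≤ suc ∣ A₁ ∩ A₂ ∣
  meets-both⇒t≤suc∣∩∣ eB h₁ h₂ = +-cancelʳ-≤ t t (suc ∣ A₁ ∩ A₂ ∣) (≤-trans (t+t≤∣∩∣+∣∪∣ h₁ h₂) ∩+∪≤)
    where
    ∩+∪≤ : ∣ (B ∩ A₁) ∩ (B ∩ A₂) ∣ + ∣ (B ∩ A₁) ∪ (B ∩ A₂) ∣ ≤ suc ∣ A₁ ∩ A₂ ∣ + t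
    ∩+∪≤ = subst (∣ (B ∩ A₁) ∩ (B ∩ A₂) ∣ + ∣ (B ∩ A₁) ∪ (B ∩ A₂) ∣ ≤_) (+-suc _ t)
      (+-mono-≤ (≤-trans (p⊆q⇒∣p∣≤∣q∣ ∩⊆) (∣p∩q∣≤∣q∣ B (A₁ ∩ A₂)))
                (≤-trans (p⊆q⇒∣p∣≤∣q∣ ∪⊆) (≤-trans (∣p∩q∣≤∣p∣ B (A₁ ∪ A₂)) (≤-reflexive eB))))

-- When A₃ ⊆ A₁ ∪ A₂ misses a point of A₁ ∩ A₂, a (t+1)-set B ⊇ A₁ ∩ A₂ leaving
-- A₁ ∪ A₂ would meet A₃ only inside A₁ ∩ A₂ − A₃, i.e. in fewer than t points.
meets-three⇒⊆∪ : (A₁ A₂ A₃ B : Subset n) (t : ℕ) → ∣ A₁ ∩ A₂ ∣ ≡ t → ¬ (A₁ ∩ A₂ ⊆ A₃) → A₃ ⊆ A₁ ∪ A₂ →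
  ∣ B ∣ ≡ suc t → t ≤ ∣ B ∩ A₁ ∣ → t ≤ ∣ B ∩ A₂ ∣ → t ≤ ∣ B ∩ A₃ ∣ → B ⊆ A₁ ∪ A₂
meets-three⇒⊆∪ A₁ A₂ A₃ B t eW W⊈A₃ A₃⊆T eB h₁ h₂ h₃ with A₁ ∩ A₂ ⊆? B | B ⊆? A₁ ∪ A₂
... | no W⊈B | _ = meets-both⇒⊆∪ A₁ A₂ B t eB h₁ h₂
        (subst (_< t) (cong ∣_∣ (∩-comm (A₁ ∩ A₂) B)) (subst (∣ (A₁ ∩ A₂) ∩ B ∣ <_) eW (p⊈q⇒∣p∩q∣<∣p∣ (A₁ ∩ A₂) B W⊈B)))
... | yes _ | yes B⊆T = B⊆T
... | yes W⊆B | no B⊈T = ⊥-elim (≤⇒≯ h₃ B∩A₃<t)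
  where
  W = A₁ ∩ A₂
  T = A₁ ∪ A₂
  W≡B∩T : W ≡ B ∩ T
  W≡B∩T = p⊆q∧∣q∣≤∣p∣⇒p≡q W (B ∩ T) (λ x∈W → ∈∩⁺ (W⊆B x∈W) (p⊆p∪q A₂ (p∩q⊆p A₁ A₂ x∈W)))
    (subst (∣ B ∩ T ∣ ≤_) (sym eW) (≤-pred (subst (∣ B ∩ T ∣ <_) eB (p⊈q⇒∣p∩q∣<∣p∣ B T B⊈T))))
  B∩A₃⊆W∩A₃ : B ∩ A₃ ⊆ W ∩ A₃
  B∩A₃⊆W∩A₃ x∈ = ∈∩⁺ (subst (_ ∈_) (sym W≡B∩T) (∈∩⁺ (p∩q⊆p B A₃ x∈) (A₃⊆T (p∩q⊆q B A₃ x∈)))) (p∩q⊆q B A₃ x∈)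
  B∩A₃<t : ∣ B ∩ A₃ ∣ < t
  B∩A₃<t = ≤-<-trans (p⊆q⇒∣p∣≤∣q∣ B∩A₃⊆W∩A₃) (subst (∣ W ∩ A₃ ∣ <_) eW (p⊈q⇒∣p∩q∣<∣p∣ W A₃ W⊈A₃))

∣p∩q∣+∣p∪q─p∣≡∣q∣ : (p q : Subset n) → ∣ p ∩ q ∣ + ∣ (p ∪ q) ─ p ∣ ≡ ∣ q ∣
∣p∩q∣+∣p∪q─p∣≡∣q∣ p q = +-cancelˡ-≡ ∣ p ∣ _ _ (begin
  ∣ p ∣ + (∣ p ∩ q ∣ + ∣ (p ∪ q) ─ p ∣)                 ≡⟨ +-exchange ∣ p ∣ ∣ p ∩ q ∣ _ ⟩
  ∣ p ∩ q ∣ + (∣ p ∣ + ∣ (p ∪ q) ─ p ∣)                 ≡⟨ cong (λ k → ∣ p ∩ q ∣ + (k + ∣ (p ∪ q) ─ p ∣)) (q⊆p⇒∣p∩q∣≡∣q∣ (p ∪ q) p (p⊆p∪q q)) ⟨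
  ∣ p ∩ q ∣ + (∣ (p ∪ q) ∩ p ∣ + ∣ (p ∪ q) ─ p ∣)       ≡⟨ cong (∣ p ∩ q ∣ +_) (∣p∩q∣+∣p─q∣≡∣p∣ (p ∪ q) p) ⟩
  ∣ p ∩ q ∣ + ∣ p ∪ q ∣                                 ≡⟨ ∣p∩q∣+∣p∪q∣≡∣p∣+∣q∣ p q ⟩
  ∣ p ∣ + ∣ q ∣                                         ∎)
  where
  open ≡-Reasoning
  +-exchange : ∀ a b c → a + (b + c) ≡ b + (a + c)
  +-exchange = solve-∀

p⊈q⇒∣q∩p∣<∣p∣ : (p q : Subset n) → ¬ (p ⊆ q) → ∣ q ∩ p ∣ < ∣ p ∣
p⊈q⇒∣q∩p∣<∣p∣ p q p⊈q = subst (_< ∣ p ∣) (cong ∣_∣ (∩-comm p q)) (p⊈q⇒∣p∩q∣<∣p∣ p q p⊈q)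

extension≡⁅x⁆∪ : (W A : Subset n) {x : Fin n} → W ⊆ A → ∣ A ∣ ≡ suc ∣ W ∣ → x ∈ A → x ∉ W → A ≡ ⁅ x ⁆ ∪ W
extension≡⁅x⁆∪ W A {x} W⊆A eA x∈A x∉W =
  sym (p⊆q∧∣q∣≤∣p∣⇒p≡q (⁅ x ⁆ ∪ W) A (⁅x⁆∪p⊆q x∈A W⊆A) (≤-reflexive (trans eA (sym (x∉p⇒∣⁅x⁆∪p∣≡suc∣p∣ W x∉W)))))

∈⋃⁻ : (As : List (Subset n)) {x : Fin n} → x ∈ ⋃ As → ∃[ A ] (A ∈ᶠ As × x ∈ A)
∈⋃⁻ [] x∈ = ⊥-elim (∉⊥ x∈)
∈⋃⁻ (A ∷ As) x∈ with x∈p∪q⁻ A (⋃ As) x∈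
... | inj₁ x∈A = A , here refl , x∈A
... | inj₂ x∈⋃ with B , B∈ , x∈B ← ∈⋃⁻ As x∈⋃ = B , there B∈ , x∈B

⊆⋃ : (As : List (Subset n)) {A : Subset n} → A ∈ᶠ As → A ⊆ ⋃ As
⊆⋃ (_ ∷ As) (here refl) = p⊆p∪q (⋃ As)
⊆⋃ (B ∷ As) (there A∈) = q⊆p∪q B (⋃ As) ∘ ⊆⋃ As A∈

∪-shuffle : (p q r : Subset n) → p ∪ ((q ∪ p) ∪ r) ≡ q ∪ (p ∪ r)
∪-shuffle {n} p q r = prove 3 (x ⊕ ((y ⊕ x) ⊕ z)) (y ⊕ (x ⊕ z)) (p ∷ q ∷ r ∷ [])
  where
  open ∪-Solver (∪-idempotentCommutativeMonoid n)
  x y z : Expr 3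
  x = var zero
  y = var (suc zero)
  z = var (suc (suc zero))

-- Counting in lists

module _ {A : Set} where

  remove : (xs : List A) {x : A} → x ∈ᶠ xs → List A
  remove (_ ∷ xs) (here _) = xs
  remove (y ∷ xs) (there x∈) = y ∷ remove xs x∈

  length-remove : (xs : List A) {x : A} (x∈ : x ∈ᶠ xs) → suc (length (remove xs x∈)) ≡ length xs
  length-remove (_ ∷ xs) (here _) = refl
  length-remove (y ∷ xs) (there x∈) = cong suc (length-remove xs x∈)

  ∈-remove : (xs : List A) {x y : A} (x∈ : x ∈ᶠ xs) → y ∈ᶠ xs → y ≢ x → y ∈ᶠ remove xs x∈
  ∈-remove (_ ∷ xs) (here refl) (here refl) y≢x = ⊥-elim (y≢x refl)
  ∈-remove (_ ∷ xs) (here refl) (there y∈) y≢x = y∈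
  ∈-remove (_ ∷ xs) (there x∈) (here refl) y≢x = here refl
  ∈-remove (_ ∷ xs) (there x∈) (there y∈) y≢x = there (∈-remove xs x∈ y∈ y≢x)

  distinct⇒2≤length : {xs : List A} {a b : A} → a ∈ᶠ xs → b ∈ᶠ xs → a ≢ b → 2 ≤ length xs
  distinct⇒2≤length {_ ∷ _ ∷ _} _ _ _ = s≤s (s≤s z≤n)
  distinct⇒2≤length {_ ∷ []} (here refl) (here refl) a≢b = ⊥-elim (a≢b refl)
  distinct⇒2≤length {_ ∷ []} (here _) (there ()) _
  distinct⇒2≤length {_ ∷ []} (there ()) _ _

  2≤length⇒distinct : (xs : List A) → Unique xs → 2 ≤ length xs → ∃[ a ] ∃[ b ] (a ∈ᶠ xs × b ∈ᶠ xs × a ≢ b)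
  2≤length⇒distinct (a ∷ b ∷ _) ((a≢b ∷ _) ∷ _) _ = a , b , here refl , there (here refl) , a≢b
  2≤length⇒distinct (_ ∷ []) _ (s≤s ())

  2≤length-filter : {P : A → Set} (P? : Decidable P) {xs : List A} {a b : A} →
    a ∈ᶠ xs → b ∈ᶠ xs → a ≢ b → P a → P b → 2 ≤ length (filter P? xs)
  2≤length-filter P? a∈ b∈ a≢b pa pb = distinct⇒2≤length (∈-filter⁺ P? a∈ pa) (∈-filter⁺ P? b∈ pb) a≢b

  length-filter-filter≤ : {P Q : A → Set} (P? : Decidable P) (Q? : Decidable Q) (xs : List A) →
    length (filter P? (filter Q? xs)) ≤ length (filter P? xs)
  length-filter-filter≤ P? Q? [] = z≤n
  length-filter-filter≤ P? Q? (x ∷ xs) with Q? x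
  ... | yes _ with P? x
  ...   | yes _ = s≤s (length-filter-filter≤ P? Q? xs)
  ...   | no _ = length-filter-filter≤ P? Q? xs
  length-filter-filter≤ P? Q? (x ∷ xs) | no _ with P? x
  ...   | yes _ = m≤n⇒m≤1+n (length-filter-filter≤ P? Q? xs)
  ...   | no _ = length-filter-filter≤ P? Q? xs

  module _ {P Q : A → Set} (P? : Decidable P) (Q? : Decidable Q) where

    length-filter-complementary : (∀ x → P x → ¬ Q x) → (∀ x → ¬ P x → Q x) → ∀ xs →
      length (filter P? xs) + length (filter Q? xs) ≡ length xs
    length-filter-complementary P⇒¬Q ¬P⇒Q [] = refl
    length-filter-complementary P⇒¬Q ¬P⇒Q (x ∷ xs) with P? x | Q? x
    ... | yes p | yes q = ⊥-elim (P⇒¬Q x p q)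
    ... | yes _ | no _ = cong suc (length-filter-complementary P⇒¬Q ¬P⇒Q xs)
    ... | no _ | yes _ = trans (+-suc _ _) (cong suc (length-filter-complementary P⇒¬Q ¬P⇒Q xs))
    ... | no ¬p | no ¬q = ⊥-elim (¬q (¬P⇒Q x ¬p))

    length-filter-cong-on : (xs : List A) → (∀ {x} → x ∈ᶠ xs → P x → Q x) → (∀ {x} → x ∈ᶠ xs → Q x → P x) →
      length (filter P? xs) ≡ length (filter Q? xs)
    length-filter-cong-on [] P⇒Q Q⇒P = refl
    length-filter-cong-on (x ∷ xs) P⇒Q Q⇒P with P? x | Q? x
    ... | yes _ | yes _ = cong suc (length-filter-cong-on xs (P⇒Q ∘ there) (Q⇒P ∘ there))
    ... | yes p | no ¬q = ⊥-elim (¬q (P⇒Q (here refl) p))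
    ... | no ¬p | yes q = ⊥-elim (¬p (Q⇒P (here refl) q))
    ... | no _ | no _ = length-filter-cong-on xs (P⇒Q ∘ there) (Q⇒P ∘ there)

  Unique⇒count≡≤1 : {a : A} (_≟a : Decidable (_≡ a)) (xs : List A) → Unique xs → length (filter _≟a xs) ≤ 1
  Unique⇒count≡≤1 _≟a [] _ = z≤n
  Unique⇒count≡≤1 {a} _≟a (x ∷ xs) (x∉xs ∷ u) with x ≟a
  ... | no _ = Unique⇒count≡≤1 _≟a xs u
  ... | yes refl = s≤s (≤-reflexive (cong length (filter-none _≟a (All.map (_∘ sym) x∉xs))))

  unique-map⁺ : {B : Set} (f : A → B) {xs : List A} → Unique xs →
    (∀ {x y} → x ∈ᶠ xs → y ∈ᶠ xs → f x ≡ f y → x ≡ y) → Unique (map f xs)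
  unique-map⁺ f {[]} [] f-inj = []
  unique-map⁺ f {x ∷ xs} (x∉xs ∷ u) f-inj = fx∉ x∉xs (λ y∈ → y∈) ∷ unique-map⁺ f u (λ x∈ y∈ → f-inj (there x∈) (there y∈))
    where
    fx∉ : ∀ {ys} → All (x ≢_) ys → (∀ {y} → y ∈ᶠ ys → y ∈ᶠ xs) → All (f x ≢_) (map f ys)
    fx∉ [] _ = []
    fx∉ (x≢y ∷ x≢ys) ys⊆xs = (x≢y ∘ f-inj (here refl) (there (ys⊆xs (here refl)))) ∷ fx∉ x≢ys (ys⊆xs ∘ there)

  sum-map-≤ : (f : A → ℕ) (c : ℕ) (xs : List A) → All (λ x → f x ≤ c) xs → sum (map f xs) ≤ length xs * c
  sum-map-≤ f c [] [] = z≤n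
  sum-map-≤ f c (x ∷ xs) (h ∷ hs) = +-mono-≤ h (sum-map-≤ f c xs hs)

  sum-map-≥ : (f : A → ℕ) (c : ℕ) (xs : List A) → All (λ x → c ≤ f x) xs → length xs * c ≤ sum (map f xs)
  sum-map-≥ f c [] [] = z≤n
  sum-map-≥ f c (x ∷ xs) (h ∷ hs) = +-mono-≤ h (sum-map-≥ f c xs hs)

  sum-map-≤-tight : (f : A → ℕ) (c : ℕ) (xs : List A) → All (λ x → f x ≤ c) xs →
    length xs * c ≤ sum (map f xs) → All (λ x → f x ≡ c) xs
  sum-map-≤-tight f c [] [] _ = []
  sum-map-≤-tight f c (x ∷ xs) (h ∷ hs) le =
    ≤-antisym h (+-cancelʳ-≤ _ c (f x) (≤-trans le (+-monoʳ-≤ (f x) (sum-map-≤ f c xs hs)))) ∷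
    sum-map-≤-tight f c xs hs (+-cancelˡ-≤ c _ _ (≤-trans le (+-monoˡ-≤ (sum (map f xs)) h)))

  sum-map-≥-tight : (f : A → ℕ) (c : ℕ) (xs : List A) → All (λ x → c ≤ f x) xs →
    sum (map f xs) ≤ length xs * c → All (λ x → f x ≡ c) xs
  sum-map-≥-tight f c [] [] _ = []
  sum-map-≥-tight f c (x ∷ xs) (h ∷ hs) le =
    ≤-antisym (+-cancelʳ-≤ _ (f x) c (≤-trans (+-monoʳ-≤ (f x) (sum-map-≥ f c xs hs)) le)) h ∷
    sum-map-≥-tight f c xs hs (+-cancelˡ-≤ c _ _ (≤-trans (+-monoˡ-≤ (sum (map f xs)) h) le))

  lookup₂ : {R : A → A → Set} {xs : List A} → All (λ x → All (R x) xs) xs → ∀ {x y} → x ∈ᶠ xs → y ∈ᶠ xs → R x y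
  lookup₂ Rxs x∈ y∈ = all-lookup (all-lookup Rxs x∈) y∈

module _ {A C : Set} where

  injective-code⇒length≤ : (R : A → C → Set) (xs : List A) (cs : List C) → Unique xs →
    (∀ {x} → x ∈ᶠ xs → ∃[ c ] (c ∈ᶠ cs × R x c)) →
    (∀ {x y c} → x ∈ᶠ xs → y ∈ᶠ xs → R x c → R y c → x ≡ y) →
    length xs ≤ length cs
  injective-code⇒length≤ R [] cs _ _ _ = z≤n
  injective-code⇒length≤ R (x ∷ xs) cs u@(_ ∷ u′) code code-inj with c , c∈ , Rxc ← code (here refl) =
    subst (suc (length xs) ≤_) (length-remove cs c∈)
      (s≤s (injective-code⇒length≤ R xs (remove cs c∈) u′ code′ (λ y∈ z∈ → code-inj (there y∈) (there z∈))))
    where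
    code′ : ∀ {y} → y ∈ᶠ xs → ∃[ d ] (d ∈ᶠ remove cs c∈ × R y d)
    code′ {y} y∈ with d , d∈ , Ryd ← code (there y∈) = d , ∈-remove cs c∈ d∈ d≢c , Ryd
      where
      d≢c : d ≢ c
      d≢c refl = UP.Unique[x∷xs]⇒x∉xs u (subst (_∈ᶠ xs) (sym (code-inj (here refl) (there y∈) Rxc Ryd)) y∈)

  length-cartesianProduct : (xs : List A) (ys : List C) → length (cartesianProduct xs ys) ≡ length xs * length ys
  length-cartesianProduct [] ys = refl
  length-cartesianProduct (x ∷ xs) ys =
    trans (length-++ (map (x ,_) ys)) (cong₂ _+_ (length-map (x ,_) ys) (length-cartesianProduct xs ys))

  module _ {R : A → C → Set} (R? : ∀ x y → Dec (R x y)) where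

    private
      indicator : A → C → ℕ
      indicator x y = if does (R? x y) then 1 else 0

      length-filter≡sum-indicator : ∀ x (ys : List C) → length (filter (R? x) ys) ≡ sum (map (indicator x) ys)
      length-filter≡sum-indicator x [] = refl
      length-filter≡sum-indicator x (y ∷ ys) with R? x y
      ... | yes _ = cong suc (length-filter≡sum-indicator x ys)
      ... | no _ = length-filter≡sum-indicator x ys

      sum-map-+ : (g h : C → ℕ) (ys : List C) → sum (map (λ y → g y + h y) ys) ≡ sum (map g ys) + sum (map h ys)
      sum-map-+ g h [] = refl
      sum-map-+ g h (y ∷ ys) = trans (cong (g y + h y +_) (sum-map-+ g h ys)) (+-interchange (g y) (h y) _ _)
        where
        +-interchange : ∀ a b c d → a + b + (c + d) ≡ a + c + (b + d)
        +-interchange = solve-∀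

      sum-map-0 : (ys : List C) → sum (map (λ _ → 0) ys) ≡ 0
      sum-map-0 [] = refl
      sum-map-0 (_ ∷ ys) = sum-map-0 ys

    double-counting : (xs : List A) (ys : List C) →
      sum (map (λ x → length (filter (R? x) ys)) xs) ≡ sum (map (λ y → length (filter (λ x → R? x y) xs)) ys)
    double-counting [] ys = sym (sum-map-0 ys)
    double-counting (x ∷ xs) ys = begin
      length (filter (R? x) ys) + sum (map (λ x → length (filter (R? x) ys)) xs)
        ≡⟨ cong₂ _+_ (length-filter≡sum-indicator x ys) (double-counting xs ys) ⟩
      sum (map (indicator x) ys) + sum (map (λ y → length (filter (λ x → R? x y) xs)) ys)
        ≡⟨ sum-map-+ (indicator x) (λ y → length (filter (λ x → R? x y) xs)) ys ⟨
      sum (map (λ y → indicator x y + length (filter (λ x → R? x y) xs)) ys)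
        ≡⟨ cong sum (map-cong (λ y → step y) ys) ⟩
      sum (map (λ y → length (filter (λ x → R? x y) (x ∷ xs))) ys) ∎
      where
      open ≡-Reasoning
      step : ∀ y → indicator x y + length (filter (λ x → R? x y) xs) ≡ length (filter (λ x → R? x y) (x ∷ xs))
      step y with R? x y
      ... | yes _ = refl
      ... | no _ = refl

elements : Subset n → List (Fin n)
elements [] = []
elements (true ∷ p) = zero ∷ map suc (elements p)
elements (false ∷ p) = map suc (elements p)

length-elements : (p : Subset n) → length (elements p) ≡ ∣ p ∣
length-elements [] = refl
length-elements (true ∷ p) = cong suc (trans (length-map suc (elements p)) (length-elements p))
length-elements (false ∷ p) = trans (length-map suc (elements p)) (length-elements p)

∈-elements⁺ : (p : Subset n) {x : Fin n} → x ∈ p → x ∈ᶠ elements p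
∈-elements⁺ (true ∷ p) here = here refl
∈-elements⁺ (true ∷ p) (there x∈p) = there (∈-map⁺ suc (∈-elements⁺ p x∈p))
∈-elements⁺ (false ∷ p) (there x∈p) = ∈-map⁺ suc (∈-elements⁺ p x∈p)

∈-elements⁻ : (p : Subset n) {x : Fin n} → x ∈ᶠ elements p → x ∈ p
∈-elements⁻ (true ∷ p) (here refl) = here
∈-elements⁻ (true ∷ p) (there x∈) with y , y∈ , refl ← ∈-map⁻ suc x∈ = there (∈-elements⁻ p y∈)
∈-elements⁻ (false ∷ p) x∈ with y , y∈ , refl ← ∈-map⁻ suc x∈ = there (∈-elements⁻ p y∈)

elements-unique : (p : Subset n) → Unique (elements p)
elements-unique [] = []
elements-unique (true ∷ p) = zero∉ (elements p) ∷ UP.map⁺ Fin-suc-injective (elements-unique p)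
  where
  zero∉ : ∀ {k} (xs : List (Fin k)) → All (Fin.zero ≢_) (map Fin.suc xs)
  zero∉ [] = []
  zero∉ (_ ∷ xs) = (λ ()) ∷ zero∉ xs
elements-unique (false ∷ p) = UP.map⁺ Fin-suc-injective (elements-unique p)

-- Each A is coded by its point outside W.
count-extensions : (W Q : Subset n) (As : List (Subset n)) → Unique As →
  All (λ A → W ⊆ A × ∣ A ∣ ≡ suc ∣ W ∣) As →
  (∀ {A x} → A ∈ᶠ As → x ∈ A → x ∉ W → x ∈ Q) → length As ≤ ∣ Q ∣
count-extensions W Q As As-unique ext new∈Q = subst (length As ≤_) (length-elements Q)
  (injective-code⇒length≤ (λ A x → x ∈ A × x ∉ W) As (elements Q) As-unique code code-inj)
  where
  code : ∀ {A} → A ∈ᶠ As → ∃[ x ] (x ∈ᶠ elements Q × (x ∈ A × x ∉ W))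
  code {A} A∈ with x , x∈A , x∉W ← extension-new-point W A (proj₁ (all-lookup ext A∈)) (proj₂ (all-lookup ext A∈)) =
    x , ∈-elements⁺ Q (new∈Q A∈ x∈A x∉W) , x∈A , x∉W
  code-inj : ∀ {A A′ x} → A ∈ᶠ As → A′ ∈ᶠ As → (x ∈ A × x ∉ W) → (x ∈ A′ × x ∉ W) → A ≡ A′
  code-inj {A} {A′} A∈ A′∈ (x∈A , x∉W) (x∈A′ , _) = extension-injective W A A′
    (proj₁ (all-lookup ext A∈)) (proj₁ (all-lookup ext A′∈)) (proj₂ (all-lookup ext A∈)) (proj₂ (all-lookup ext A′∈))
    x∈A x∈A′ x∉W

∣p∩q∣≡t⇒∣p─q∣≡1 : (p q : Subset n) {t : ℕ} → ∣ p ∣ ≡ suc t → ∣ p ∩ q ∣ ≡ t → ∣ p ─ q ∣ ≡ 1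
∣p∩q∣≡t⇒∣p─q∣≡1 p q {t} ep epq = +-cancelˡ-≡ t _ _
  (trans (trans (cong (_+ ∣ p ─ q ∣) (sym epq)) (∣p∩q∣+∣p─q∣≡∣p∣ p q)) (trans ep (+-comm 1 t)))

exchange-pair : (A B : Subset n) {t : ℕ} → ∣ A ∣ ≡ suc t → ∣ B ∣ ≡ suc t → ∣ A ∩ B ∣ ≡ t →
  ∃[ a ] ∃[ x ] (a ∈ A × a ∉ B × x ∈ B × x ∉ A)
exchange-pair A B eA eB eAB
  with a , a∈ ← 0<∣p∣⇒Nonempty (A ─ B) (subst (0 <_) (sym (∣p∩q∣≡t⇒∣p─q∣≡1 A B eA eAB)) (s≤s z≤n))
     | x , x∈ ← 0<∣p∣⇒Nonempty (B ─ A) (subst (0 <_) (sym (∣p∩q∣≡t⇒∣p─q∣≡1 B A eB (trans (cong ∣_∣ (∩-comm B A)) eAB))) (s≤s z≤n))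
  = a , x , p─q⊆p A B a∈ , x∈p─q⇒x∉q A B a∈ , p─q⊆p B A x∈ , x∈p─q⇒x∉q B A x∈

exchange-pair-injective : (A B B′ : Subset n) {t : ℕ} {a x : Fin n} →
  ∣ A ∣ ≡ suc t → ∣ B ∣ ≡ suc t → ∣ B′ ∣ ≡ suc t → ∣ A ∩ B ∣ ≡ t → ∣ A ∩ B′ ∣ ≡ t →
  a ∈ A → a ∉ B → a ∉ B′ → x ∈ B → x ∈ B′ → x ∉ A → B ≡ B′
exchange-pair-injective A B B′ eA eB eB′ eAB eAB′ a∈A a∉B a∉B′ x∈B x∈B′ x∉A =
  p⊆q∧∣q∣≤∣p∣⇒p≡q B B′ B⊆B′ (≤-reflexive (trans eB′ (sym eB)))
  where
  B⊆B′ : B ⊆ B′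
  B⊆B′ {y} y∈B with y ∈? A | y ∈? B′
  ... | _ | yes y∈B′ = y∈B′
  ... | no y∉A | no _ rewrite ∣p∣≤1⇒x≡y (B ─ A) (≤-reflexive (∣p∩q∣≡t⇒∣p─q∣≡1 B A eB (trans (cong ∣_∣ (∩-comm B A)) eAB)))
        (x∈p∧x∉q⇒x∈p─q y∈B y∉A) (x∈p∧x∉q⇒x∈p─q x∈B x∉A) = x∈B′
  ... | yes y∈A | no y∉B′ rewrite ∣p∣≤1⇒x≡y (A ─ B′) (≤-reflexive (∣p∩q∣≡t⇒∣p─q∣≡1 A B′ eA eAB′))
        (x∈p∧x∉q⇒x∈p─q y∈A y∉B′) (x∈p∧x∉q⇒x∈p─q a∈A a∉B′) = ⊥-elim (a∉B y∈B)

-- Each B is coded by its exchange pair (a , x) ∈ P × Q.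
count-exchanges : (A P Q : Subset n) {t : ℕ} → ∣ A ∣ ≡ suc t → (Bs : List (Subset n)) → Unique Bs →
  All (λ B → ∣ B ∣ ≡ suc t × ∣ A ∩ B ∣ ≡ t) Bs →
  (∀ {B a x} → B ∈ᶠ Bs → a ∈ A → a ∉ B → x ∈ B → x ∉ A → a ∈ P × x ∈ Q) →
  length Bs ≤ ∣ P ∣ * ∣ Q ∣
count-exchanges {n} A P Q eA Bs Bs-unique sizes pair∈P×Q =
  subst (length Bs ≤_) (trans (length-cartesianProduct (elements P) (elements Q)) (cong₂ _*_ (length-elements P) (length-elements Q)))
    (injective-code⇒length≤ Exchange Bs (cartesianProduct (elements P) (elements Q)) Bs-unique code code-inj)
  where
  Exchange : Subset n → Fin n × Fin n → Set
  Exchange B (a , x) = a ∈ A × a ∉ B × x ∈ B × x ∉ A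
  code : ∀ {B} → B ∈ᶠ Bs → ∃[ c ] (c ∈ᶠ cartesianProduct (elements P) (elements Q) × Exchange B c)
  code {B} B∈ with a , x , a∈A , a∉B , x∈B , x∉A ← exchange-pair A B eA (proj₁ (all-lookup sizes B∈)) (proj₂ (all-lookup sizes B∈))
    with a∈P , x∈Q ← pair∈P×Q B∈ a∈A a∉B x∈B x∉A
    = (a , x) , ∈-cartesianProduct⁺ (∈-elements⁺ P a∈P) (∈-elements⁺ Q x∈Q) , a∈A , a∉B , x∈B , x∉A
  code-inj : ∀ {B B′ c} → B ∈ᶠ Bs → B′ ∈ᶠ Bs → Exchange B c → Exchange B′ c → B ≡ B′
  code-inj {B} {B′} B∈ B′∈ (a∈A , a∉B , x∈B , x∉A) (_ , a∉B′ , x∈B′ , _) =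
    exchange-pair-injective A B B′ eA (proj₁ (all-lookup sizes B∈)) (proj₁ (all-lookup sizes B′∈))
      (proj₂ (all-lookup sizes B∈)) (proj₂ (all-lookup sizes B′∈)) a∈A a∉B a∉B′ x∈B x∈B′ x∉A

_≟ˢ_ : (A B : Subset n) → Dec (A ≡ B)
_≟ˢ_ = ≡-dec Bool._≟_

-- t-intersection among (t+1)-subsets of Fin n

module TIntersection (n t : ℕ) where

  Intersecting : Subset n → Subset n → Set
  Intersecting A B = t ≤ ∣ A ∩ B ∣

  intersecting? : (A : Subset n) → Decidable (Intersecting A)
  intersecting? A B = t ≤? ∣ A ∩ B ∣

  disjoint? : (A : Subset n) → Decidable (λ B → ∣ A ∩ B ∣ < t)
  disjoint? A B = ∣ A ∩ B ∣ <? t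

  numIntersecting : Subset n → Family n → ℕ
  numIntersecting A G = length (filter (intersecting? A) G)

  numDisjoint+numIntersecting≡length : ∀ A G → numTDisjoint t A G + numIntersecting A G ≡ length G
  numDisjoint+numIntersecting≡length A G =
    length-filter-complementary (disjoint? A) (intersecting? A) (λ _ → <⇒≱) (λ _ → ≮⇒≥) G

  intersecting-sym : ∀ A B → Intersecting A B → Intersecting B A
  intersecting-sym A B = subst (t ≤_) (cong ∣_∣ (∩-comm A B))

  intersecting-refl : ∀ {A} → ∣ A ∣ ≡ suc t → Intersecting A A
  intersecting-refl {A} eA = subst (t ≤_) (cong ∣_∣ (sym (∩-idem A))) (subst (t ≤_) (sym eA) (n≤1+n t))

  ⊆⇒intersecting : ∀ {W A B} → ∣ W ∣ ≡ t → W ⊆ A → W ⊆ B → Intersecting A B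
  ⊆⇒intersecting {W} {A} {B} eW W⊆A W⊆B = subst (_≤ ∣ A ∩ B ∣) eW (p⊆q⇒∣p∣≤∣q∣ (λ x∈W → ∈∩⁺ (W⊆A x∈W) (W⊆B x∈W)))

  distinct-intersecting⇒∣∩∣≡t : ∀ {A B} → ∣ A ∣ ≡ suc t → ∣ B ∣ ≡ suc t → A ≢ B → Intersecting A B → ∣ A ∩ B ∣ ≡ t
  distinct-intersecting⇒∣∩∣≡t {A} {B} eA eB A≢B = ≤-antisym
    (≤-pred (subst (∣ A ∩ B ∣ <_) eA (distinct⇒∣p∩q∣<∣p∣ A B (trans eA (sym eB)) A≢B)))

  -- Besides A itself, such B meet A in exactly t points and are coded by their exchange pair with A.
  count-intersecting : (A P Q : Subset n) → ∣ A ∣ ≡ suc t → (Bs : Family n) → Unique Bs →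
    All (λ B → ∣ B ∣ ≡ suc t × Intersecting A B) Bs →
    (∀ {B a x} → B ∈ᶠ Bs → a ∈ A → a ∉ B → x ∈ B → x ∉ A → a ∈ P × x ∈ Q) →
    length Bs ≤ suc (∣ P ∣ * ∣ Q ∣)
  count-intersecting A P Q eA Bs Bs-unique meets pair∈P×Q = begin
    length Bs                                        ≡⟨ length-filter-complementary (_≟ˢ A) (λ B → ¬? (B ≟ˢ A)) (λ _ B≡A B≢A → B≢A B≡A) (λ _ B≢A → B≢A) Bs ⟨
    length (filter (_≟ˢ A) Bs) + length Bs≢A        ≤⟨ +-mono-≤ (Unique⇒count≡≤1 (_≟ˢ A) Bs Bs-unique) Bs≢A≤ ⟩
    suc (∣ P ∣ * ∣ Q ∣)                              ∎
    where
    open ≤-Reasoning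
    Bs≢A = filter (λ B → ¬? (B ≟ˢ A)) Bs
    ∈Bs : ∀ {B} → B ∈ᶠ Bs≢A → B ∈ᶠ Bs × B ≢ A
    ∈Bs = ∈-filter⁻ (λ B → ¬? (B ≟ˢ A)) {xs = Bs}
    Bs≢A≤ : length Bs≢A ≤ ∣ P ∣ * ∣ Q ∣
    Bs≢A≤ = count-exchanges A P Q eA Bs≢A (UP.filter⁺ _ Bs-unique)
      (All.tabulate (λ B∈ → let B∈Bs , B≢A = ∈Bs B∈ ; eB , A∼B = all-lookup meets B∈Bs in
         eB , distinct-intersecting⇒∣∩∣≡t eA eB (B≢A ∘ sym) A∼B))
      (pair∈P×Q ∘ proj₁ ∘ ∈Bs)

  count-inside-extension : (A T : Subset n) → ∣ A ∣ ≡ suc t → A ⊆ T → ∣ T ─ A ∣ ≤ 1 →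
    (Bs : Family n) → Unique Bs → All (λ B → ∣ B ∣ ≡ suc t × B ⊆ T) Bs → length Bs ≤ suc (suc t)
  count-inside-extension A T eA A⊆T ∣T─A∣≤1 Bs Bs-unique Bs⊆T = begin
    length Bs                     ≤⟨ count-intersecting A A (T ─ A) eA Bs Bs-unique (All.map (λ {B} → meets B) Bs⊆T)
                                       (λ B∈ a∈A _ x∈B x∉A → a∈A , x∈p∧x∉q⇒x∈p─q (proj₂ (all-lookup Bs⊆T B∈) x∈B) x∉A) ⟩
    suc (∣ A ∣ * ∣ T ─ A ∣)       ≤⟨ s≤s (*-mono-≤ (≤-reflexive eA) ∣T─A∣≤1) ⟩
    suc (suc t * 1)               ≡⟨ cong suc (*-identityʳ (suc t)) ⟩
    suc (suc t)                   ∎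
    where
    open ≤-Reasoning
    ∣T∣≤ : ∣ T ∣ ≤ suc (suc t)
    ∣T∣≤ = begin
      ∣ T ∣                      ≡⟨ ∣p∩q∣+∣p─q∣≡∣p∣ T A ⟨
      ∣ T ∩ A ∣ + ∣ T ─ A ∣      ≤⟨ +-mono-≤ (≤-reflexive (trans (q⊆p⇒∣p∩q∣≡∣q∣ T A A⊆T) eA)) ∣T─A∣≤1 ⟩
      suc t + 1                  ≡⟨ +-comm (suc t) 1 ⟩
      suc (suc t)                ∎
    meets : ∀ B → ∣ B ∣ ≡ suc t × B ⊆ T → ∣ B ∣ ≡ suc t × Intersecting A B
    meets B (eB , B⊆T) = eB , +-cancelʳ-≤ (suc (suc t)) t ∣ A ∩ B ∣ (begin
      t + suc (suc t)            ≡⟨ +-suc t (suc t) ⟩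
      suc t + suc t              ≡⟨ trans (∣p∩q∣+∣p∪q∣≡∣p∣+∣q∣ A B) (cong₂ _+_ eA eB) ⟨
      ∣ A ∩ B ∣ + ∣ A ∪ B ∣      ≤⟨ +-monoʳ-≤ ∣ A ∩ B ∣ (≤-trans (p⊆q⇒∣p∣≤∣q∣ (λ x∈ → [ A⊆T , B⊆T ]′ (x∈p∪q⁻ A B x∈))) ∣T∣≤) ⟩
      ∣ A ∩ B ∣ + suc (suc t)    ∎)

  numIntersecting≤ : (A : Subset n) → ∣ A ∣ ≡ suc t → (G : Family n) → Unique G → All (λ B → ∣ B ∣ ≡ suc t) G →
    numIntersecting A G ≤ suc (suc t * (n ∸ suc t))
  numIntersecting≤ A eA G G-unique G-sizes = begin
    numIntersecting A G          ≤⟨ count-intersecting A A (∁ A) eA GA (UP.filter⁺ _ G-unique)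
                                      (All.tabulate (λ B∈ → let B∈G , A∼B = ∈-filter⁻ (intersecting? A) {xs = G} B∈ in
                                                             all-lookup G-sizes B∈G , A∼B))
                                      (λ _ a∈A _ _ x∉A → a∈A , x∉p⇒x∈∁p x∉A) ⟩
    suc (∣ A ∣ * ∣ ∁ A ∣)        ≡⟨ cong₂ (λ a b → suc (a * b)) eA (trans (∣∁p∣≡n∸∣p∣ A) (cong (n ∸_) eA)) ⟩
    suc (suc t * (n ∸ suc t))    ∎
    where
    open ≤-Reasoning
    GA = filter (intersecting? A) G

  -- If A, A′ are not t-intersecting, every B meeting both lies in A ∪ A′, which has at most
  -- two points outside A; so B is coded by an exchange pair in A × ((A ∪ A′) ─ A).
  count-meeting-both : (A A′ : Subset n) → ∣ A ∣ ≡ suc t → ∣ A′ ∣ ≡ suc t → ∣ A ∩ A′ ∣ < t →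
    (Bs : Family n) → Unique Bs → All (λ B → ∣ B ∣ ≡ suc t × Intersecting A B × Intersecting A′ B) Bs →
    length Bs ≤ suc t * 2
  count-meeting-both A A′ eA eA′ A∩A′<t [] _ _ = z≤n
  count-meeting-both A A′ eA eA′ A∩A′<t Bs@(B₀ ∷ _) Bs-unique meets = begin
    length Bs                    ≤⟨ count-exchanges A A ((A ∪ A′) ─ A) eA Bs Bs-unique (All.tabulate (λ B∈ → size B∈ , ∣A∩B∣≡t B∈)) codes ⟩
    ∣ A ∣ * ∣ (A ∪ A′) ─ A ∣     ≤⟨ *-mono-≤ (≤-reflexive eA) ∣A∪A′─A∣≤2 ⟩
    suc t * 2                    ∎
    where
    open ≤-Reasoning
    size : ∀ {B} → B ∈ᶠ Bs → ∣ B ∣ ≡ suc t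
    size B∈ = proj₁ (all-lookup meets B∈)
    meets-A : ∀ {B} → B ∈ᶠ Bs → t ≤ ∣ B ∩ A ∣
    meets-A {B} B∈ = intersecting-sym A B (proj₁ (proj₂ (all-lookup meets B∈)))
    meets-A′ : ∀ {B} → B ∈ᶠ Bs → t ≤ ∣ B ∩ A′ ∣
    meets-A′ {B} B∈ = intersecting-sym A′ B (proj₂ (proj₂ (all-lookup meets B∈)))
    ∣A∩B∣≡t : ∀ {B} → B ∈ᶠ Bs → ∣ A ∩ B ∣ ≡ t
    ∣A∩B∣≡t {B} B∈ = distinct-intersecting⇒∣∩∣≡t eA (size B∈) A≢B (proj₁ (proj₂ (all-lookup meets B∈)))
      where
      A≢B : A ≢ B
      A≢B refl = ≤⇒≯ (meets-A′ B∈) A∩A′<t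
    codes : ∀ {B a x} → B ∈ᶠ Bs → a ∈ A → a ∉ B → x ∈ B → x ∉ A → a ∈ A × x ∈ (A ∪ A′) ─ A
    codes {B} B∈ a∈A _ x∈B x∉A = a∈A , x∈p∧x∉q⇒x∈p─q
      (meets-both⇒⊆∪ A A′ B t (size B∈) (meets-A B∈) (meets-A′ B∈) (≤-<-trans (∣p∩q∣≤∣q∣ B (A ∩ A′)) A∩A′<t) x∈B) x∉A
    ∣A∪A′─A∣≤2 : ∣ (A ∪ A′) ─ A ∣ ≤ 2
    ∣A∪A′─A∣≤2 = +-cancelʳ-≤ t _ 2 (begin
      ∣ (A ∪ A′) ─ A ∣ + t               ≤⟨ +-monoʳ-≤ _ (meets-both⇒t≤suc∣∩∣ A A′ B₀ t (size (here refl)) (meets-A (here refl)) (meets-A′ (here refl))) ⟩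
      ∣ (A ∪ A′) ─ A ∣ + suc ∣ A ∩ A′ ∣  ≡⟨ +-suc ∣ (A ∪ A′) ─ A ∣ ∣ A ∩ A′ ∣ ⟩
      suc (∣ (A ∪ A′) ─ A ∣ + ∣ A ∩ A′ ∣) ≡⟨ cong suc (trans (+-comm ∣ (A ∪ A′) ─ A ∣ ∣ A ∩ A′ ∣) (∣p∩q∣+∣p∪q─p∣≡∣q∣ A A′)) ⟩
      suc ∣ A′ ∣                         ≡⟨ cong suc eA′ ⟩
      2 + t                              ∎)

  StarOn : Subset n → Family n → Set
  StarOn W F = All (λ A → W ⊆ A × ∣ A ∣ ≡ suc t) F

  module _ (W : Subset n) (eW : ∣ W ∣ ≡ t) where

    star-∣A∣≡suc∣W∣ : (A : Subset n) → ∣ A ∣ ≡ suc t → ∣ A ∣ ≡ suc ∣ W ∣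
    star-∣A∣≡suc∣W∣ A eA = trans eA (cong suc (sym eW))

    -- A (t+1)-set B ⊉ W meets W in at most t − 1 points, so it can t-intersect only the
    -- members W ∪ {x} with x ∈ B ─ W, and ∣ B ─ W ∣ ≤ 2.
    star-numIntersecting≤2 : (F : Family n) → Unique F → StarOn W F →
      (B : Subset n) → ∣ B ∣ ≡ suc t → ¬ (W ⊆ B) → numIntersecting B F ≤ 2
    star-numIntersecting≤2 F F-unique star B eB W⊈B with filter (intersecting? B) F in eq
    ... | [] = z≤n
    ... | A₀ ∷ _ = subst (λ FB → length FB ≤ 2) eq (≤-trans
      (count-extensions W (B ─ W) FB (UP.filter⁺ _ F-unique)
        (All.tabulate (λ {A} A∈ → W⊆ A∈ , star-∣A∣≡suc∣W∣ A (proj₂ (all-lookup star (∈F A∈))))) codes)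
      ∣B─W∣≤2)
      where
      FB = filter (intersecting? B) F
      ∈F : ∀ {A} → A ∈ᶠ FB → A ∈ᶠ F
      ∈F A∈ = proj₁ (∈-filter⁻ (intersecting? B) {xs = F} A∈)
      W⊆ : ∀ {A} → A ∈ᶠ FB → W ⊆ A
      W⊆ A∈ = proj₁ (all-lookup star (∈F A∈))
      B∩W<t : ∣ B ∩ W ∣ < t
      B∩W<t = subst (∣ B ∩ W ∣ <_) eW (p⊈q⇒∣q∩p∣<∣p∣ W B W⊈B)
      codes : ∀ {A x} → A ∈ᶠ FB → x ∈ A → x ∉ W → x ∈ B ─ W
      codes {A} {x} A∈ x∈A x∉W with x ∈? B
      ... | yes x∈B = x∈p∧x∉q⇒x∈p─q x∈B x∉W
      ... | no x∉B = ⊥-elim (≤⇒≯ (proj₂ (∈-filter⁻ (intersecting? B) {xs = F} A∈)) (subst (_< t)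
              (sym (∣∩extension∣-new∉ W A B (W⊆ A∈) (star-∣A∣≡suc∣W∣ A (proj₂ (all-lookup star (∈F A∈)))) x∈A x∉W x∉B)) B∩W<t))
      A₀∈ : A₀ ∈ᶠ FB
      A₀∈ = subst (A₀ ∈ᶠ_) (sym eq) (here refl)
      ∣B─W∣≤2 : ∣ B ─ W ∣ ≤ 2
      ∣B─W∣≤2 = +-cancelʳ-≤ t _ 2 (begin
        ∣ B ─ W ∣ + t                ≤⟨ +-monoʳ-≤ _ (≤-trans (proj₂ (∈-filter⁻ (intersecting? B) {xs = F} A₀∈))
                                          (∣∩extension∣≤ W A₀ B (W⊆ A₀∈) (star-∣A∣≡suc∣W∣ A₀ (proj₂ (all-lookup star (∈F A₀∈)))))) ⟩
        ∣ B ─ W ∣ + suc ∣ B ∩ W ∣    ≡⟨ trans (+-suc ∣ B ─ W ∣ ∣ B ∩ W ∣) (cong suc (+-comm ∣ B ─ W ∣ ∣ B ∩ W ∣)) ⟩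
        suc (∣ B ∩ W ∣ + ∣ B ─ W ∣)  ≡⟨ cong suc (trans (∣p∩q∣+∣p─q∣≡∣p∣ B W) eB) ⟩
        2 + t                        ∎)
        where open ≤-Reasoning

    count-⊇ : (Bs : Family n) → Unique Bs → All (λ B → ∣ B ∣ ≡ suc t × W ⊆ B) Bs → length Bs ≤ n ∸ t
    count-⊇ Bs Bs-unique sizes = subst (length Bs ≤_) (trans (∣∁p∣≡n∸∣p∣ W) (cong (n ∸_) eW))
      (count-extensions W (∁ W) Bs Bs-unique
        (All.map (λ {B} B-size → proj₂ B-size , star-∣A∣≡suc∣W∣ B (proj₁ B-size)) sizes) (λ _ _ → x∉p⇒x∈∁p))

    ∣W∪⋃star∣ : (F : Family n) → Unique F → StarOn W F → ∣ W ∪ ⋃ F ∣ ≡ t + length F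
    ∣W∪⋃star∣ [] _ _ = trans (cong ∣_∣ (∪-identityʳ W)) (trans eW (sym (+-identityʳ t)))
    ∣W∪⋃star∣ (A ∷ F) (A∉F ∷ F-unique) ((W⊆A , eA) ∷ star)
      with x , x∈A , x∉W ← extension-new-point W A W⊆A (star-∣A∣≡suc∣W∣ A eA) = begin
      ∣ W ∪ (A ∪ ⋃ F) ∣               ≡⟨ cong (λ A → ∣ W ∪ (A ∪ ⋃ F) ∣) (extension≡⁅x⁆∪ W A W⊆A (star-∣A∣≡suc∣W∣ A eA) x∈A x∉W) ⟩
      ∣ W ∪ ((⁅ x ⁆ ∪ W) ∪ ⋃ F) ∣     ≡⟨ cong ∣_∣ (∪-shuffle W ⁅ x ⁆ (⋃ F)) ⟩
      ∣ ⁅ x ⁆ ∪ (W ∪ ⋃ F) ∣           ≡⟨ x∉p⇒∣⁅x⁆∪p∣≡suc∣p∣ (W ∪ ⋃ F) x∉W∪⋃F ⟩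
      suc ∣ W ∪ ⋃ F ∣                 ≡⟨ cong suc (∣W∪⋃star∣ F F-unique star) ⟩
      suc (t + length F)              ≡⟨ +-suc t (length F) ⟨
      t + length (A ∷ F)              ∎
      where
      open ≡-Reasoning
      x∉W∪⋃F : x ∉ W ∪ ⋃ F
      x∉W∪⋃F x∈ with x∈p∪q⁻ W (⋃ F) x∈
      ... | inj₁ x∈W = x∉W x∈W
      ... | inj₂ x∈⋃F with B , B∈F , x∈B ← ∈⋃⁻ F x∈⋃F with W⊆B , eB ← all-lookup star B∈F =
        all-lookup A∉F B∈F (extension-injective W A B W⊆A W⊆B (star-∣A∣≡suc∣W∣ A eA) (star-∣A∣≡suc∣W∣ B eB) x∈A x∈B x∉W)

  numDisjoint-comm : ∀ A (F : Family n) → numTDisjoint t A F ≡ length (filter (λ C → disjoint? C A) F)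
  numDisjoint-comm A F = cong length (filter-≐ (disjoint? A) (λ C → disjoint? C A)
    ((λ {C} → subst (_< t) (cong ∣_∣ (∩-comm A C))) , (λ {C} → subst (_< t) (cong ∣_∣ (∩-comm C A)))) F)

  Σ-numDisjoint-comm : (F G : Family n) →
    sum (map (λ A → numTDisjoint t A G) F) ≡ sum (map (λ B → numTDisjoint t B F) G)
  Σ-numDisjoint-comm F G = trans (double-counting disjoint? F G)
    (cong sum (map-cong (λ B → sym (numDisjoint-comm B F)) G))

-- Arithmetic consequences of n ≥ 5 s (t + 1)²

-- The products |𝓕| |𝓖| of the two extremal configurations (i) and (ii).
L₁ : ℕ → ℕ → ℕ → ℕ
L₁ n t s = suc (suc t * (n ∸ suc t)) + s

L₂ : ℕ → ℕ → ℕ → ℕ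
L₂ n t s = (s + 2) * (n ∸ t + (s + 2))

<-by-slack : ∀ {a b} c → suc a + c ≡ b → a < b
<-by-slack {a} c eq = subst (suc a ≤_) eq (m≤m+n (suc a) c)

n∸t≡suc[n∸[1+t]] : ∀ {n t} → t < n → n ∸ t ≡ suc (n ∸ suc t)
n∸t≡suc[n∸[1+t]] = +-∸-assoc 1

-- Below, t = suc v and s = suc w, and every inequality becomes an identity between
-- polynomials with natural coefficients once n ∸ k is written as 4 s (t + 1)² + r.
n∸k≡4s[t+1]²+r : ∀ n k v w → k ≤ suc (suc v) → 5 * suc w * (suc v + 1) ^ 2 ≤ n →
  ∃[ r ] (n ∸ k ≡ 4 * suc w * ((2 + v) * (2 + v)) + r)
n∸k≡4s[t+1]²+r n k v w k≤t+1 big = n ∸ k ∸ 4s[t+1]² , sym (m+[n∸m]≡n 4s[t+1]²≤n∸k)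
  where
  4s[t+1]² = 4 * suc w * ((2 + v) * (2 + v))
  5s[t+1]²≡ : ∀ v w → 5 * suc w * ((suc v + 1) * ((suc v + 1) * 1)) ≡ 4 * suc w * ((2 + v) * (2 + v)) + suc w * ((2 + v) * (2 + v))
  5s[t+1]²≡ = solve-∀
  k≤s[t+1]² : k ≤ suc w * ((2 + v) * (2 + v))
  k≤s[t+1]² = ≤-trans k≤t+1 (≤-trans (m≤m*n (2 + v) (2 + v)) (m≤n*m ((2 + v) * (2 + v)) (suc w)))
  4s[t+1]²≤n∸k : 4s[t+1]² ≤ n ∸ k
  4s[t+1]²≤n∸k = m+n≤o⇒m≤o∸n 4s[t+1]² (≤-trans (+-monoʳ-≤ 4s[t+1]² k≤s[t+1]²) (subst (_≤ n) (5s[t+1]²≡ v w) big))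

t+[s+2]≤n : ∀ {n} t s → 1 ≤ t → 1 ≤ s → 5 * s * (t + 1) ^ 2 ≤ n → t + (s + 2) ≤ n
t+[s+2]≤n {n} (suc v) (suc w) _ _ big = ≤-trans (m≤m+n _ _) (subst (_≤ n) (n≡ v w) big)
  where
  n≡ : ∀ v w → 5 * suc w * ((suc v + 1) * ((suc v + 1) * 1))
               ≡ suc v + (suc w + 2) + (16 + 19 * v + 19 * w + 5 * v * v + 20 * v * w + 5 * v * v * w)
  n≡ = solve-∀

nonintersecting<L₂ : ∀ n t s → 1 ≤ t → 1 ≤ s → 5 * s * (t + 1) ^ 2 ≤ n →
  (suc t * 2 + 2 * s) * (suc t * 2 + 2 * s) < L₂ n t s
nonintersecting<L₂ n (suc v) (suc w) _ _ big =
  let r , n∸t≡ = n∸k≡4s[t+1]²+r n (suc v) v w (n≤1+n _) big in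
  subst (λ X → (suc (suc v) * 2 + 2 * suc w) * (suc (suc v) * 2 + 2 * suc w) < (suc w + 2) * (X + (suc w + 2)))
    (sym n∸t≡) (<-by-slack _ (L₂≡ v w r))
  where
  L₂≡ : ∀ v w r → suc ((suc (suc v) * 2 + 2 * suc w) * (suc (suc v) * 2 + 2 * suc w))
                    + (20 + 3 * r + 24 * v + 46 * w + r * w + 8 * v * v + 56 * v * w + 13 * w * w
                       + 16 * v * v * w + 16 * v * w * w + 4 * v * v * w * w)
                  ≡ (suc w + 2) * ((4 * suc w * ((2 + v) * (2 + v)) + r) + (suc w + 2))
  L₂≡ = solve-∀

nonstar<L₂ : ∀ n t s → 1 ≤ t → 1 ≤ s → 5 * s * (t + 1) ^ 2 ≤ n →
  suc (suc t) * (suc (suc t) + 3 * s) < L₂ n t s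
nonstar<L₂ n (suc v) (suc w) _ _ big =
  let r , n∸t≡ = n∸k≡4s[t+1]²+r n (suc v) v w (n≤1+n _) big in
  subst (λ X → suc (suc (suc v)) * (suc (suc (suc v)) + 3 * suc w) < (suc w + 2) * (X + (suc w + 2)))
    (sym n∸t≡) (<-by-slack _ (L₂≡ v w r))
  where
  L₂≡ : ∀ v w r → suc (suc (suc (suc v)) * (suc (suc (suc v)) + 3 * suc w))
                    + (38 + 3 * r + 39 * v + 61 * w + r * w + 11 * v * v + 61 * v * w + 17 * w * w
                       + 16 * v * v * w + 16 * v * w * w + 4 * v * v * w * w)
                  ≡ (suc w + 2) * ((4 * suc w * ((2 + v) * (2 + v)) + r) + (suc w + 2))
  L₂≡ = solve-∀

star-pair<L₂ : ∀ n t s → 1 ≤ t → 1 ≤ s → 5 * s * (t + 1) ^ 2 ≤ n →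
  ∀ a g → a ≤ n ∸ t → g ≤ suc (suc t) + 2 * s → 2 * (a + g) < L₂ n t s
star-pair<L₂ n (suc v) (suc w) _ _ big a g a≤ g≤ =
  let r , n∸t≡ = n∸k≡4s[t+1]²+r n (suc v) v w (n≤1+n _) big in
  subst (λ X → 2 * (a + g) < (suc w + 2) * (X + (suc w + 2))) (sym n∸t≡)
    (≤-<-trans (*-monoʳ-≤ 2 (+-mono-≤ (≤-trans a≤ (≤-reflexive n∸t≡)) g≤)) (<-by-slack _ (L₂≡ v w r)))
  where
  L₂≡ : ∀ v w r → suc (2 * ((4 * suc w * ((2 + v) * (2 + v)) + r) + (suc (suc (suc v)) + 2 * suc w)))
                    + (14 + r + 14 * v + 34 * w + r * w + 4 * v * v + 32 * v * w + 17 * w * w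
                       + 8 * v * v * w + 16 * v * w * w + 4 * v * v * w * w)
                  ≡ (suc w + 2) * ((4 * suc w * ((2 + v) * (2 + v)) + r) + (suc w + 2))
  L₂≡ = solve-∀

-- For a star of m = 3 + p members (so s = 2 + p + q): g (m ∸ 2) ≤ m s gives g ≤ 3 s,
-- hence m g ≤ m s + 6 s, and m (a + g) ≤ m (n ∸ t) + m s + 6 s < L₂.
star<L₂ : ∀ n t s → 1 ≤ t → 1 ≤ s → 5 * s * (t + 1) ^ 2 ≤ n →
  ∀ m a g → 3 ≤ m → m ≤ s + 1 → a ≤ n ∸ t → g * (m ∸ 2) ≤ m * s → m * (a + g) < L₂ n t s
star<L₂ n (suc v) (suc w) _ _ big (suc (suc (suc p))) a g (s≤s (s≤s (s≤s _))) m≤s+1 a≤ g[m∸2]≤ms =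
  let q , 2+p+q≡s = m≤n⇒∃[o]m+o≡n (≤-pred (subst (3 + p ≤_) (+-comm (suc w) 1) m≤s+1))
      r , n∸t≡ = n∸k≡4s[t+1]²+r n (suc v) v w (n≤1+n _) big
  in bound q r 2+p+q≡s n∸t≡
  where
  m = 3 + p
  X = n ∸ suc v
  bound : ∀ q r → 2 + p + q ≡ suc w → X ≡ 4 * suc w * ((2 + v) * (2 + v)) + r → m * (a + g) < L₂ n (suc v) (suc w)
  bound q r 2+p+q≡s n∸t≡ = begin-strict
    m * (a + g)                    ≡⟨ *-distribˡ-+ m a g ⟩
    m * a + m * g                  ≤⟨ +-mono-≤ (*-monoʳ-≤ m a≤) mg≤ ⟩
    m * X + (m * S + 2 * (3 * S))  ≡⟨ cong (λ X → m * X + (m * S + 2 * (3 * S))) X≡ ⟩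
    m * X′ + (m * S + 2 * (3 * S)) <⟨ <-by-slack _ (L₂≡ p q v r) ⟩
    (S + 2) * (X′ + (S + 2))       ≡⟨ cong (λ X → (S + 2) * (X + (S + 2))) X≡ ⟨
    (S + 2) * (X + (S + 2))        ≡⟨ cong (λ S → (S + 2) * (X + (S + 2))) 2+p+q≡s ⟩
    L₂ n (suc v) (suc w)           ∎
    where
    open ≤-Reasoning
    S = 2 + p + q
    X′ = 4 * S * ((2 + v) * (2 + v)) + r
    X≡ : X ≡ X′
    X≡ = trans n∸t≡ (cong (λ S → 4 * S * ((2 + v) * (2 + v)) + r) (sym 2+p+q≡s))
    g[1+p]≤mS : g * suc p ≤ m * S
    g[1+p]≤mS = subst (λ S → g * suc p ≤ m * S) (sym 2+p+q≡s) g[m∸2]≤ms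
    g≤3S : g ≤ 3 * S
    g≤3S = *-cancelʳ-≤ g (3 * S) (suc p) (≤-trans g[1+p]≤mS (≤-trans (*-monoˡ-≤ S m≤3[1+p]) (≤-reflexive (3[1+p]S≡ p S))))
      where
      m≤3[1+p] : m ≤ 3 * suc p
      m≤3[1+p] = subst (m ≤_) (3+p+2p≡ p) (m≤m+n m (p + p))
        where
        3+p+2p≡ : ∀ p → 3 + p + (p + p) ≡ 3 * suc p
        3+p+2p≡ = solve-∀
      3[1+p]S≡ : ∀ p S → 3 * suc p * S ≡ 3 * S * suc p
      3[1+p]S≡ = solve-∀
    mg≤ : m * g ≤ m * S + 2 * (3 * S)
    mg≤ = subst (_≤ m * S + 2 * (3 * S)) (sym (mg≡ p g)) (+-mono-≤ g[1+p]≤mS (*-monoʳ-≤ 2 g≤3S))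
      where
      mg≡ : ∀ p g → (3 + p) * g ≡ g * suc p + 2 * g
      mg≡ = solve-∀
    L₂≡ : ∀ p q v r → let S = 2 + p + q ; X = 4 * S * ((2 + v) * (2 + v)) + r in
      suc ((3 + p) * X + ((3 + p) * S + 2 * (3 * S)))
      + (29 + 13 * p + 47 * q + r + 32 * v + 17 * p * q + 16 * p * v + 17 * q * q + q * r + 48 * q * v + 8 * v * v
         + 16 * p * q * v + 4 * p * v * v + 16 * q * q * v + 12 * q * v * v + 4 * p * q * v * v + 4 * q * q * v * v)
      ≡ (S + 2) * (X + (S + 2))
    L₂≡ = solve-∀

L₁<L₂ : ∀ n t s → 1 ≤ t → 1 ≤ s → 5 * s * (t + 1) ^ 2 ≤ n → t ≤ s + 1 → L₁ n t s < L₂ n t s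
L₁<L₂ n t s t≥1 s≥1 big t≤s+1 = begin-strict
  suc (suc t * Y) + s        ≤⟨ +-monoˡ-≤ s (s≤s (*-monoˡ-≤ Y t+1≤s+2)) ⟩
  suc ((s + 2) * Y) + s      <⟨ <-by-slack _ (L₂≡ s Y) ⟩
  (s + 2) * (suc Y + (s + 2))  ≡⟨ cong (λ X → (s + 2) * (X + (s + 2))) (n∸t≡suc[n∸[1+t]] t<n) ⟨
  L₂ n t s                   ∎
  where
  open ≤-Reasoning
  Y = n ∸ suc t
  t<n : t < n
  t<n = <-≤-trans (m<m+n t (≤-trans (s≤s z≤n) (m≤n+m 2 s))) (t+[s+2]≤n t s t≥1 s≥1 big)
  t+1≤s+2 : suc t ≤ s + 2
  t+1≤s+2 = subst (suc t ≤_) (sym (+-suc s 1)) (s≤s t≤s+1)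
  L₂≡ : ∀ s Y → suc (suc ((s + 2) * Y) + s) + (4 + 4 * s + s * s) ≡ (s + 2) * (suc Y + (s + 2))
  L₂≡ = solve-∀

L₂<L₁ : ∀ n t s → 1 ≤ t → 1 ≤ s → 5 * s * (t + 1) ^ 2 ≤ n → s + 2 ≤ t → L₂ n t s < L₁ n t s
L₂<L₁ n (suc v) (suc w) t≥1 s≥1 big s+2≤t =
  let q , w+2+q≡v = m≤n⇒∃[o]m+o≡n (≤-pred s+2≤t)
      r , n∸[t+1]≡ = n∸k≡4s[t+1]²+r n (suc (suc v)) v w ≤-refl big
  in bound q r w+2+q≡v n∸[t+1]≡
  where
  Y = n ∸ suc (suc v)
  t<n : suc v < n
  t<n = <-≤-trans (m<m+n (suc v) (≤-trans (s≤s z≤n) (m≤n+m 2 (suc w)))) (t+[s+2]≤n (suc v) (suc w) t≥1 s≥1 big)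
  bound : ∀ q r → w + 2 + q ≡ v → Y ≡ 4 * suc w * ((2 + v) * (2 + v)) + r → L₂ n (suc v) (suc w) < L₁ n (suc v) (suc w)
  bound q r w+2+q≡v n∸[t+1]≡ = begin-strict
    (suc w + 2) * (n ∸ suc v + (suc w + 2))  ≡⟨ cong (λ X → (suc w + 2) * (X + (suc w + 2))) (n∸t≡suc[n∸[1+t]] t<n) ⟩
    (suc w + 2) * (suc Y + (suc w + 2))      ≡⟨ cong (λ Y → (suc w + 2) * (suc Y + (suc w + 2))) n∸[t+1]≡ ⟩
    (suc w + 2) * (suc (Y′ v) + (suc w + 2)) <⟨ subst (λ v → (suc w + 2) * (suc (Y′ v) + (suc w + 2)) < suc (suc (suc v) * Y′ v) + suc w)
                                                   w+2+q≡v (<-by-slack _ (L₁≡ w q r)) ⟩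
    suc (suc (suc v) * Y′ v) + suc w         ≡⟨ cong (λ Y → suc (suc (suc v) * Y) + suc w) n∸[t+1]≡ ⟨
    L₁ n (suc v) (suc w)                     ∎
    where
    open ≤-Reasoning
    Y′ : ℕ → ℕ
    Y′ v = 4 * suc w * ((2 + v) * (2 + v)) + r
    L₁≡ : ∀ w q r → let Y = 4 * suc w * ((2 + (w + 2 + q)) * (2 + (w + 2 + q))) + r in
      suc ((suc w + 2) * (suc Y + (suc w + 2)))
      + (53 + 96 * q + r + 90 * w + 36 * q * q + q * r + 136 * q * w + 35 * w * w + 4 * q * q * q
         + 44 * q * q * w + 44 * q * w * w + 4 * w * w * w + 4 * q * q * q * w + 8 * q * q * w * w + 4 * q * w * w * w)
      ≡ suc (suc (suc (w + 2 + q)) * Y) + suc w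
    L₁≡ = solve-∀

-- Size bounds for s-almost cross-t-intersecting pairs

module AlmostCrossIntersecting (n t s : ℕ) where

  open TIntersection n t

  length≤numIntersecting+s : ∀ A G → numTDisjoint t A G ≤ s → length G ≤ numIntersecting A G + s
  length≤numIntersecting+s A G h = begin
    length G                                        ≡⟨ numDisjoint+numIntersecting≡length A G ⟨
    numTDisjoint t A G + numIntersecting A G       ≤⟨ +-monoˡ-≤ _ h ⟩
    s + numIntersecting A G                        ≡⟨ +-comm s _ ⟩
    numIntersecting A G + s                        ∎
    where open ≤-Reasoning

  meetingAll : Family n → Family n → Family n
  meetingAll [] G = G
  meetingAll (A ∷ As) G = filter (intersecting? A) (meetingAll As G)

  ∈-meetingAll⁻ : ∀ As {G B} → B ∈ᶠ meetingAll As G → B ∈ᶠ G × All (λ A → Intersecting A B) As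
  ∈-meetingAll⁻ [] B∈ = B∈ , []
  ∈-meetingAll⁻ (A ∷ As) {G} B∈ with B∈′ , A∼B ← ∈-filter⁻ (intersecting? A) {xs = meetingAll As G} B∈
    with B∈G , As∼B ← ∈-meetingAll⁻ As B∈′ = B∈G , A∼B ∷ As∼B

  meetingAll-unique : ∀ As {G} → Unique G → Unique (meetingAll As G)
  meetingAll-unique [] G-unique = G-unique
  meetingAll-unique (A ∷ As) G-unique = UP.filter⁺ (intersecting? A) (meetingAll-unique As G-unique)

  numDisjoint-meetingAll≤ : ∀ As A G → numTDisjoint t A (meetingAll As G) ≤ numTDisjoint t A G
  numDisjoint-meetingAll≤ [] A G = ≤-refl
  numDisjoint-meetingAll≤ (A′ ∷ As) A G =
    ≤-trans (length-filter-filter≤ (disjoint? A) (intersecting? A′) (meetingAll As G)) (numDisjoint-meetingAll≤ As A G)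

  length≤meetingAll+ : ∀ As G → All (λ A → numTDisjoint t A G ≤ s) As →
    length G ≤ length (meetingAll As G) + length As * s
  length≤meetingAll+ [] G [] = ≤-reflexive (sym (+-identityʳ (length G)))
  length≤meetingAll+ (A ∷ As) G (h ∷ hs) = begin
    length G                                                    ≤⟨ length≤meetingAll+ As G hs ⟩
    length (meetingAll As G) + length As * s                    ≤⟨ +-monoˡ-≤ _ (length≤numIntersecting+s A (meetingAll As G) (≤-trans (numDisjoint-meetingAll≤ As A G) h)) ⟩
    length (meetingAll (A ∷ As) G) + s + length As * s          ≡⟨ +-assoc (length (meetingAll (A ∷ As) G)) s (length As * s) ⟩
    length (meetingAll (A ∷ As) G) + length (A ∷ As) * s        ∎
    where open ≤-Reasoning

  size-suc : (X : Subset n) → ∣ X ∣ ≡ t + 1 → ∣ X ∣ ≡ suc t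
  size-suc X eX = trans eX (+-comm t 1)

  module Unpack {F G : Family n} (adm : Admissible n t s F G) where

    F-unique : Unique F
    F-unique = proj₁ (proj₁ adm)

    G-unique : Unique G
    G-unique = proj₁ (proj₁ (proj₂ adm))

    F-sizes : All (λ A → ∣ A ∣ ≡ suc t) F
    F-sizes = All.map (λ {X} → size-suc X) (proj₂ (proj₁ adm))

    G-sizes : All (λ B → ∣ B ∣ ≡ suc t) G
    G-sizes = All.map (λ {X} → size-suc X) (proj₂ (proj₁ (proj₂ adm)))

    F-almost : All (λ A → numTDisjoint t A G ≤ s) F
    F-almost = proj₁ (proj₁ (proj₂ (proj₂ adm)))

    G-almost : All (λ B → numTDisjoint t B F ≤ s) G
    G-almost = proj₂ (proj₁ (proj₂ (proj₂ adm)))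

    not-cross : ¬ CrossTIntersecting t F G
    not-cross = proj₁ (proj₂ (proj₂ (proj₂ adm)))

    ∣F∣≤∣G∣ : length F ≤ length G
    ∣F∣≤∣G∣ = proj₂ (proj₂ (proj₂ (proj₂ adm)))

    disjoint-pair : ∃[ A ] ∃[ B ] (A ∈ᶠ F × B ∈ᶠ G × ∣ A ∩ B ∣ < t)
    disjoint-pair with A , A∈ , A≁G ← find (¬All⇒Any¬ (λ A → all? (intersecting? A) G) F not-cross)
      with B , B∈ , A≁B ← find (¬All⇒Any¬ (intersecting? A) G A≁G) = A , B , A∈ , B∈ , ≰⇒> A≁B

  nonintersecting-pair⇒length≤ : (A A′ : Subset n) (G : Family n) → Unique G → All (λ B → ∣ B ∣ ≡ suc t) G →
    ∣ A ∣ ≡ suc t → ∣ A′ ∣ ≡ suc t → ∣ A ∩ A′ ∣ < t → numTDisjoint t A G ≤ s → numTDisjoint t A′ G ≤ s →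
    length G ≤ suc t * 2 + 2 * s
  nonintersecting-pair⇒length≤ A A′ G G-unique G-sizes eA eA′ A∩A′<t hA hA′ =
    ≤-trans (length≤meetingAll+ (A′ ∷ A ∷ []) G (hA′ ∷ hA ∷ [])) (+-monoˡ-≤ (2 * s)
      (count-meeting-both A A′ eA eA′ A∩A′<t (meetingAll (A′ ∷ A ∷ []) G) (meetingAll-unique (A′ ∷ A ∷ []) G-unique)
        (All.tabulate (λ B∈ → case B∈))))
    where
    case : ∀ {B} → B ∈ᶠ meetingAll (A′ ∷ A ∷ []) G → ∣ B ∣ ≡ suc t × Intersecting A B × Intersecting A′ B
    case B∈ with B∈G , A′∼B ∷ A∼B ∷ [] ← ∈-meetingAll⁻ (A′ ∷ A ∷ []) B∈ = all-lookup G-sizes B∈G , A∼B , A′∼B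

  ∣A₁∪A₂─A₁∣≤1 : (A₁ A₂ : Subset n) → ∣ A₁ ∩ A₂ ∣ ≡ t → ∣ A₂ ∣ ≡ suc t → ∣ (A₁ ∪ A₂) ─ A₁ ∣ ≤ 1
  ∣A₁∪A₂─A₁∣≤1 A₁ A₂ eW eA₂ = ≤-reflexive (+-cancelˡ-≡ t _ _
    (trans (cong (_+ ∣ (A₁ ∪ A₂) ─ A₁ ∣) (sym eW)) (trans (∣p∩q∣+∣p∪q─p∣≡∣q∣ A₁ A₂) (trans eA₂ (+-comm 1 t)))))

  -- If A₁, A₂, A₃ ∈ 𝓕 pairwise t-intersect but A₃ ⊉ A₁ ∩ A₂, every (t+1)-set t-intersecting all
  -- three lies in the (t+2)-set A₁ ∪ A₂.
  non-star⇒lengths≤ : (A₁ A₂ A₃ : Subset n) (F G : Family n) → Unique F → Unique G →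
    All (λ A → ∣ A ∣ ≡ suc t) F → All (λ B → ∣ B ∣ ≡ suc t) G →
    (∀ {A A′} → A ∈ᶠ F → A′ ∈ᶠ F → Intersecting A A′) →
    A₁ ∈ᶠ F → A₂ ∈ᶠ F → A₃ ∈ᶠ F → ∣ A₁ ∩ A₂ ∣ ≡ t → ¬ (A₁ ∩ A₂ ⊆ A₃) →
    numTDisjoint t A₁ G ≤ s → numTDisjoint t A₂ G ≤ s → numTDisjoint t A₃ G ≤ s →
    length F ≤ suc (suc t) × length G ≤ suc (suc t) + 3 * s
  non-star⇒lengths≤ A₁ A₂ A₃ F G F-unique G-unique F-sizes G-sizes F-intersecting A₁∈ A₂∈ A₃∈ eW W⊈A₃ h₁ h₂ h₃ =
    count-inside-extension A₁ T eA₁ (p⊆p∪q A₂) ∣T─A₁∣≤1 F F-unique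
      (All.tabulate (λ A∈ → all-lookup F-sizes A∈ , ⊆T (all-lookup F-sizes A∈)
         (intersecting-sym A₁ _ (F-intersecting A₁∈ A∈)) (intersecting-sym A₂ _ (F-intersecting A₂∈ A∈))
         (intersecting-sym A₃ _ (F-intersecting A₃∈ A∈)))) ,
    ≤-trans (length≤meetingAll+ As G (h₃ ∷ h₂ ∷ h₁ ∷ [])) (+-monoˡ-≤ (3 * s)
      (count-inside-extension A₁ T eA₁ (p⊆p∪q A₂) ∣T─A₁∣≤1 (meetingAll As G) (meetingAll-unique As G-unique)
        (All.tabulate G-case)))
    where
    T = A₁ ∪ A₂
    As = A₃ ∷ A₂ ∷ A₁ ∷ []
    eA₁ : ∣ A₁ ∣ ≡ suc t
    eA₁ = all-lookup F-sizes A₁∈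
    ∣T─A₁∣≤1 : ∣ T ─ A₁ ∣ ≤ 1
    ∣T─A₁∣≤1 = ∣A₁∪A₂─A₁∣≤1 A₁ A₂ eW (all-lookup F-sizes A₂∈)
    A₃⊆T : A₃ ⊆ T
    A₃⊆T = meets-both⇒⊆∪ A₁ A₂ A₃ t (all-lookup F-sizes A₃∈) (F-intersecting A₃∈ A₁∈) (F-intersecting A₃∈ A₂∈)
      (subst (∣ A₃ ∩ (A₁ ∩ A₂) ∣ <_) eW (p⊈q⇒∣q∩p∣<∣p∣ (A₁ ∩ A₂) A₃ W⊈A₃))
    ⊆T : ∀ {B} → ∣ B ∣ ≡ suc t → t ≤ ∣ B ∩ A₁ ∣ → t ≤ ∣ B ∩ A₂ ∣ → t ≤ ∣ B ∩ A₃ ∣ → B ⊆ T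
    ⊆T {B} = meets-three⇒⊆∪ A₁ A₂ A₃ B t eW W⊈A₃ A₃⊆T
    G-case : ∀ {B} → B ∈ᶠ meetingAll As G → ∣ B ∣ ≡ suc t × B ⊆ T
    G-case {B} B∈ with B∈G , A₃∼B ∷ A₂∼B ∷ A₁∼B ∷ [] ← ∈-meetingAll⁻ As B∈ =
      all-lookup G-sizes B∈G , ⊆T (all-lookup G-sizes B∈G)
        (intersecting-sym A₁ B A₁∼B) (intersecting-sym A₂ B A₂∼B) (intersecting-sym A₃ B A₃∼B)

  containing notContaining : Subset n → Family n → Family n
  containing W G = filter (W ⊆?_) G
  notContaining W G = filter (λ B → ¬? (W ⊆? B)) G

  length-containing+notContaining : (W : Subset n) (G : Family n) → length (containing W G) + length (notContaining W G) ≡ length G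
  length-containing+notContaining W G = length-filter-complementary (W ⊆?_) (λ B → ¬? (W ⊆? B)) (λ _ W⊆B W⊈B → W⊈B W⊆B) (λ _ W⊈B → W⊈B) G

  module _ (W : Subset n) (eW : ∣ W ∣ ≡ t) where

    length-containing≤ : (G : Family n) → Unique G → All (λ B → ∣ B ∣ ≡ suc t) G → length (containing W G) ≤ n ∸ t
    length-containing≤ G G-unique G-sizes = count-⊇ W eW (containing W G) (UP.filter⁺ _ G-unique)
      (All.tabulate (λ B∈ → let B∈G , W⊆B = ∈-filter⁻ (W ⊆?_) {xs = G} B∈ in all-lookup G-sizes B∈G , W⊆B))

    notContaining-numDisjoint≥ : (F G : Family n) → Unique F → StarOn W F → All (λ B → ∣ B ∣ ≡ suc t) G →
      All (λ B → length F ∸ 2 ≤ numTDisjoint t B F) (notContaining W G)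
    notContaining-numDisjoint≥ F G F-unique star G-sizes = All.tabulate λ {B} B∈ →
      let B∈G , W⊈B = ∈-filter⁻ (λ B → ¬? (W ⊆? B)) {xs = G} B∈ in begin
        length F ∸ 2                                            ≡⟨ cong (_∸ 2) (numDisjoint+numIntersecting≡length B F) ⟨
        numTDisjoint t B F + numIntersecting B F ∸ 2            ≤⟨ ∸-monoˡ-≤ 2 (+-monoʳ-≤ (numTDisjoint t B F) (star-numIntersecting≤2 W eW F F-unique star B (all-lookup G-sizes B∈G) W⊈B)) ⟩
        numTDisjoint t B F + 2 ∸ 2                              ≡⟨ m+n∸n≡m (numTDisjoint t B F) 2 ⟩
        numTDisjoint t B F                                      ∎
      where open ≤-Reasoning

    -- Double counting the t-disjoint pairs between 𝓕 and the members of 𝓖 not containing W.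
    star-double-counting : (F G : Family n) → Unique F → StarOn W F → All (λ B → ∣ B ∣ ≡ suc t) G →
      All (λ A → numTDisjoint t A G ≤ s) F → length (notContaining W G) * (length F ∸ 2) ≤ length F * s
    star-double-counting F G F-unique star G-sizes F-almost = begin
      length G′ * (length F ∸ 2)                    ≤⟨ sum-map-≥ (λ B → numTDisjoint t B F) _ G′ (notContaining-numDisjoint≥ F G F-unique star G-sizes) ⟩
      sum (map (λ B → numTDisjoint t B F) G′)       ≡⟨ Σ-numDisjoint-comm F G′ ⟨
      sum (map (λ A → numTDisjoint t A G′) F)       ≤⟨ sum-map-≤ (λ A → numTDisjoint t A G′) s F (All.map (λ {A} → ≤-trans (length-filter-filter≤ (disjoint? A) _ G)) F-almost) ⟩
      length F * s                                  ∎
      where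
      open ≤-Reasoning
      G′ = notContaining W G

    star-length≤s+2 : (F G : Family n) → Unique F → StarOn W F → All (λ B → ∣ B ∣ ≡ suc t) G →
      All (λ B → numTDisjoint t B F ≤ s) G → ∀ {A B} → A ∈ᶠ F → B ∈ᶠ G → ∣ A ∩ B ∣ < t → length F ≤ s + 2
    star-length≤s+2 F G F-unique star G-sizes G-almost {A} {B} A∈ B∈ A∩B<t = begin
      length F                                  ≡⟨ numDisjoint+numIntersecting≡length B F ⟨
      numTDisjoint t B F + numIntersecting B F  ≤⟨ +-mono-≤ (all-lookup G-almost B∈) (star-numIntersecting≤2 W eW F F-unique star B (all-lookup G-sizes B∈) W⊈B) ⟩
      s + 2                                     ∎
      where
      open ≤-Reasoning
      W⊈B : ¬ (W ⊆ B)
      W⊈B W⊆B = ≤⇒≯ (⊆⇒intersecting eW (proj₁ (all-lookup star A∈)) W⊆B) A∩B<t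

  -- Members of 𝓖 not containing W = A₁ ∩ A₂ but t-intersecting A₁ and A₂ lie in A₁ ∪ A₂.
  notContaining-∩≤ : (A₁ A₂ : Subset n) (G : Family n) → Unique G → All (λ B → ∣ B ∣ ≡ suc t) G →
    ∣ A₁ ∣ ≡ suc t → ∣ A₂ ∣ ≡ suc t → ∣ A₁ ∩ A₂ ∣ ≡ t → numTDisjoint t A₁ G ≤ s → numTDisjoint t A₂ G ≤ s →
    length (notContaining (A₁ ∩ A₂) G) ≤ suc (suc t) + 2 * s
  notContaining-∩≤ A₁ A₂ G G-unique G-sizes eA₁ eA₂ eW h₁ h₂ =
    ≤-trans (length≤meetingAll+ As G′ (≤-trans (length-filter-filter≤ (disjoint? A₂) _ G) h₂ ∷ ≤-trans (length-filter-filter≤ (disjoint? A₁) _ G) h₁ ∷ []))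
      (+-monoˡ-≤ (2 * s) (count-inside-extension A₁ (A₁ ∪ A₂) eA₁ (p⊆p∪q A₂) (∣A₁∪A₂─A₁∣≤1 A₁ A₂ eW eA₂)
        (meetingAll As G′) (meetingAll-unique As (UP.filter⁺ _ G-unique)) (All.tabulate G′-case)))
    where
    G′ = notContaining (A₁ ∩ A₂) G
    As = A₂ ∷ A₁ ∷ []
    G′-case : ∀ {B} → B ∈ᶠ meetingAll As G′ → ∣ B ∣ ≡ suc t × B ⊆ A₁ ∪ A₂
    G′-case {B} B∈ with B∈G′ , A₂∼B ∷ A₁∼B ∷ [] ← ∈-meetingAll⁻ As B∈
      with B∈G , W⊈B ← ∈-filter⁻ (λ B → ¬? ((A₁ ∩ A₂) ⊆? B)) {xs = G} B∈G′ =
      all-lookup G-sizes B∈G , meets-both⇒⊆∪ A₁ A₂ B t (all-lookup G-sizes B∈G) (intersecting-sym A₁ B A₁∼B) (intersecting-sym A₂ B A₂∼B)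
        (subst (∣ B ∩ (A₁ ∩ A₂) ∣ <_) eW (p⊈q⇒∣q∩p∣<∣p∣ (A₁ ∩ A₂) B W⊈B))

  -- The shape of configuration (ii): 𝓕 is a star of s + 2 sets on a t-set W.
  record StarConfiguration (F G : Family n) : Set where
    field
      W : Subset n
      ∣W∣≡t : ∣ W ∣ ≡ t
      star : StarOn W F
      length-F : length F ≡ s + 2
      length-notContaining≤ : length (notContaining W G) ≤ s + 2

module Classification (n t s : ℕ) (t≥1 : 1 ≤ t) (s≥1 : 1 ≤ s) (big : 5 * s * (t + 1) ^ 2 ≤ n) where

  open TIntersection n t
  open AlmostCrossIntersecting n t s

  star-cases : (m a g : ℕ) → 2 ≤ m → m ≤ s + 2 → a ≤ n ∸ t → g * (m ∸ 2) ≤ m * s →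
    (m ≡ 2 → g ≤ suc (suc t) + 2 * s) → m * (a + g) < L₂ n t s ⊎ (m ≡ s + 2 × g ≤ s + 2)
  star-cases m a g 2≤m m≤s+2 a≤ g[m∸2]≤ms m≡2⇒g≤ with m ≟ 2 | m ≤? s + 1
  ... | yes refl | _ = inj₁ (star-pair<L₂ n t s t≥1 s≥1 big a g a≤ (m≡2⇒g≤ refl))
  ... | no m≢2 | yes m≤s+1 = inj₁ (star<L₂ n t s t≥1 s≥1 big m a g (≤∧≢⇒< 2≤m (m≢2 ∘ sym)) m≤s+1 a≤ g[m∸2]≤ms)
  ... | no _ | no m≰s+1 = inj₂ (m≡s+2 , g≤s+2)
    where
    m≡s+2 : m ≡ s + 2
    m≡s+2 = ≤-antisym m≤s+2 (subst (_≤ m) (sym (+-suc s 1)) (≰⇒> m≰s+1))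
    g≤s+2 : g ≤ s + 2
    g≤s+2 = *-cancelʳ-≤ g (s + 2) s {{>-nonZero s≥1}}
      (subst₂ (λ k l → g * k ≤ l * s) (trans (cong (_∸ 2) m≡s+2) (m+n∸n≡m s 2)) m≡s+2 g[m∸2]≤ms)

  module _ {F G : Family n} (adm : Admissible n t s F G) where

    open Unpack adm

    nonintersecting⇒product<L₂ : ∀ {A A′} → A ∈ᶠ F → A′ ∈ᶠ F → ¬ Intersecting A A′ → length F * length G < L₂ n t s
    nonintersecting⇒product<L₂ {A} {A′} A∈ A′∈ A≁A′ = ≤-<-trans
      (≤-trans (*-monoˡ-≤ (length G) ∣F∣≤∣G∣) (*-mono-≤ ∣G∣≤ ∣G∣≤)) (nonintersecting<L₂ n t s t≥1 s≥1 big)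
      where
      ∣G∣≤ : length G ≤ suc t * 2 + 2 * s
      ∣G∣≤ = nonintersecting-pair⇒length≤ A A′ G G-unique G-sizes (all-lookup F-sizes A∈) (all-lookup F-sizes A′∈)
        (≰⇒> A≁A′) (all-lookup F-almost A∈) (all-lookup F-almost A′∈)

    module _ (F-intersecting : ∀ {A A′} → A ∈ᶠ F → A′ ∈ᶠ F → Intersecting A A′)
             {A₁ A₂ : Subset n} (A₁∈ : A₁ ∈ᶠ F) (A₂∈ : A₂ ∈ᶠ F) (A₁≢A₂ : A₁ ≢ A₂) where

      ∣A₁∩A₂∣≡t : ∣ A₁ ∩ A₂ ∣ ≡ t
      ∣A₁∩A₂∣≡t = distinct-intersecting⇒∣∩∣≡t (all-lookup F-sizes A₁∈) (all-lookup F-sizes A₂∈) A₁≢A₂ (F-intersecting A₁∈ A₂∈)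

      non-star⇒product<L₂ : ∀ {A₃} → A₃ ∈ᶠ F → ¬ (A₁ ∩ A₂ ⊆ A₃) → length F * length G < L₂ n t s
      non-star⇒product<L₂ {A₃} A₃∈ W⊈A₃ =
        let ∣F∣≤ , ∣G∣≤ = non-star⇒lengths≤ A₁ A₂ A₃ F G F-unique G-unique F-sizes G-sizes F-intersecting A₁∈ A₂∈ A₃∈
                            ∣A₁∩A₂∣≡t W⊈A₃ (all-lookup F-almost A₁∈) (all-lookup F-almost A₂∈) (all-lookup F-almost A₃∈)
        in ≤-<-trans (*-mono-≤ ∣F∣≤ ∣G∣≤) (nonstar<L₂ n t s t≥1 s≥1 big)

      module _ (W⊆F : All (A₁ ∩ A₂ ⊆_) F) where

        star : StarOn (A₁ ∩ A₂) F
        star = All.zip (W⊆F , F-sizes)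

        ∣F∣≤s+2 : length F ≤ s + 2
        ∣F∣≤s+2 = let A , B , A∈ , B∈ , A∩B<t = disjoint-pair in
          star-length≤s+2 (A₁ ∩ A₂) ∣A₁∩A₂∣≡t F G F-unique star G-sizes G-almost A∈ B∈ A∩B<t

        -- 𝓖 splits into the members containing A₁ ∩ A₂ (at most n ∸ t of them) and the rest.
        star⇒product<L₂⊎configuration : 2 ≤ length F → length F * length G < L₂ n t s ⊎ StarConfiguration F G
        star⇒product<L₂⊎configuration 2≤∣F∣ = ⊎-map
          (subst (λ g → length F * g < L₂ n t s) (length-containing+notContaining (A₁ ∩ A₂) G))
          (λ (∣F∣≡s+2 , ∣G′∣≤s+2) → record
             { W = A₁ ∩ A₂ ; ∣W∣≡t = ∣A₁∩A₂∣≡t ; star = star ; length-F = ∣F∣≡s+2 ; length-notContaining≤ = ∣G′∣≤s+2 })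
          (star-cases (length F) (length (containing (A₁ ∩ A₂) G)) (length (notContaining (A₁ ∩ A₂) G)) 2≤∣F∣ ∣F∣≤s+2
             (length-containing≤ (A₁ ∩ A₂) ∣A₁∩A₂∣≡t G G-unique G-sizes)
             (star-double-counting (A₁ ∩ A₂) ∣A₁∩A₂∣≡t F G F-unique star G-sizes F-almost)
             (λ _ → notContaining-∩≤ A₁ A₂ G G-unique G-sizes (all-lookup F-sizes A₁∈) (all-lookup F-sizes A₂∈)
                      ∣A₁∩A₂∣≡t (all-lookup F-almost A₁∈) (all-lookup F-almost A₂∈)))

      pairwise⇒product<L₂⊎star : 2 ≤ length F → Dec (All (A₁ ∩ A₂ ⊆_) F) →
        length F * length G < L₂ n t s ⊎ StarConfiguration F G
      pairwise⇒product<L₂⊎star 2≤∣F∣ (yes W⊆F) = star⇒product<L₂⊎configuration W⊆F 2≤∣F∣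
      pairwise⇒product<L₂⊎star 2≤∣F∣ (no W⊈F) =
        let A₃ , A₃∈ , W⊈A₃ = find (¬All⇒Any¬ ((A₁ ∩ A₂) ⊆?_) F W⊈F) in inj₁ (non-star⇒product<L₂ A₃∈ W⊈A₃)

    product<L₂⊎star′ : 2 ≤ length F → Dec (All (λ A → All (Intersecting A) F) F) →
      length F * length G < L₂ n t s ⊎ StarConfiguration F G
    product<L₂⊎star′ 2≤∣F∣ (no ¬pairwise) =
      let A , A∈ , A≁F = find (¬All⇒Any¬ (λ A → all? (intersecting? A) F) F ¬pairwise)
          A′ , A′∈ , A≁A′ = find (¬All⇒Any¬ (intersecting? A) F A≁F)
      in inj₁ (nonintersecting⇒product<L₂ A∈ A′∈ A≁A′)
    product<L₂⊎star′ 2≤∣F∣ (yes pairwise) =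
      let A₁ , A₂ , A₁∈ , A₂∈ , A₁≢A₂ = 2≤length⇒distinct F F-unique 2≤∣F∣ in
      pairwise⇒product<L₂⊎star (lookup₂ pairwise) A₁∈ A₂∈ A₁≢A₂ 2≤∣F∣ (all? ((A₁ ∩ A₂) ⊆?_) F)

    product<L₂⊎star : 2 ≤ length F → length F * length G < L₂ n t s ⊎ StarConfiguration F G
    product<L₂⊎star 2≤∣F∣ = product<L₂⊎star′ 2≤∣F∣ (all? (λ A → all? (intersecting? A) F) F)

-- Structure of a maximal admissible pair

module Maximality (n t s : ℕ) where

  open TIntersection n t
  open AlmostCrossIntersecting n t s
  open DecMembership (_≟ˢ_ {n}) using () renaming (_∈?_ to _∈ᶠ?_)

  0<s+2 : 0 < s + 2
  0<s+2 = ≤-trans (s≤s z≤n) (m≤n+m 2 s)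

  Maximal : Family n → Family n → Set
  Maximal F G = ∀ (F′ G′ : Family n) → Admissible n t s F′ G′ → length F′ * length G′ ≤ length F * length G

  admissible-∷ : ∀ {F G X} → Admissible n t s F G → X ∉ᶠ G → ∣ X ∣ ≡ t + 1 → All (λ A → Intersecting A X) F →
    Admissible n t s F (X ∷ G)
  admissible-∷ {F} {G} {X} ((F-unique , F-sizes) , (G-unique , G-sizes) , (F-almost , G-almost) , not-cross , ∣F∣≤∣G∣) X∉G eX F∼X =
    (F-unique , F-sizes) , (¬Any⇒All¬ G X∉G ∷ G-unique , eX ∷ G-sizes) ,
    (All.zipWith (λ {A} (h , A∼X) → subst (_≤ s) (sym (cong length (filter-reject (disjoint? A) (≤⇒≯ A∼X)))) h) (F-almost , F∼X) ,
     subst (_≤ s) (sym (cong length (filter-none (disjoint? X) (All.map (λ {A} A∼X → ≤⇒≯ (intersecting-sym A X A∼X)) F∼X)))) z≤n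
       ∷ G-almost) ,
    (not-cross ∘ All.map (λ { (_ ∷ A∼G) → A∼G })) , m≤n⇒m≤1+n ∣F∣≤∣G∣

  -- Adding X to 𝓖 would keep the pair admissible and increase the product.
  maximal⇒∈ : ∀ {F G} → Admissible n t s F G → Maximal F G → 1 ≤ length F →
    ∀ X → ∣ X ∣ ≡ t + 1 → All (λ A → Intersecting A X) F → X ∈ᶠ G
  maximal⇒∈ {F} {G} adm maximal 1≤∣F∣ X eX F∼X with X ∈ᶠ? G
  ... | yes X∈G = X∈G
  ... | no X∉G = ⊥-elim (≤⇒≯ (maximal F (X ∷ G) (admissible-∷ adm X∉G eX F∼X)) (begin-strict
    length F * length G          <⟨ m<m+n (length F * length G) 1≤∣F∣ ⟩
    length F * length G + length F ≡⟨ +-comm _ (length F) ⟩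
    length F + length F * length G ≡⟨ *-suc (length F) (length G) ⟨
    length F * length (X ∷ G)    ∎))
    where open ≤-Reasoning

  singleton-length≤L₁ : ∀ {Y G} → Admissible n t s (Y ∷ []) G → length G ≤ L₁ n t s
  singleton-length≤L₁ {Y} {G} adm = ≤-trans (length≤numIntersecting+s Y G (all-head F-almost))
    (+-monoˡ-≤ s (numIntersecting≤ Y (all-head F-sizes) G G-unique G-sizes))
    where open Unpack adm

  Conclusion-i : Family n → Family n → Set
  Conclusion-i F G = ∃[ Y ] (∣ Y ∣ ≡ t + 1 ×
    (∀ X → (X ∈ᶠ F) ⇔ (X ≡ Y)) ×
    ∃[ 𝓒 ] (Unique 𝓒 × length 𝓒 ≡ s ×
      All (λ X → ∣ X ∣ ≡ t + 1 × ¬ M₁ Y (t + 1) t X) 𝓒 ×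
      (∀ X → (X ∈ᶠ G) ⇔ (M₁ Y (t + 1) t X ⊎ X ∈ᶠ 𝓒))))

  -- 𝓒 is the list of the members of 𝓖 that are t-disjoint from Y.
  singleton-structure : ∀ {Y G} → Admissible n t s (Y ∷ []) G → Maximal (Y ∷ []) G → L₁ n t s ≤ length G →
    Conclusion-i (Y ∷ []) G
  singleton-structure {Y} {G} adm maximal L₁≤∣G∣ =
    Y , all-head (proj₂ (proj₁ adm)) , (λ X → mk⇔ (λ { (here X≡Y) → X≡Y }) (λ { refl → here refl })) ,
    C , UP.filter⁺ _ G-unique , ∣C∣≡s ,
    All.tabulate (λ {X} X∈C → let X∈G , Y∩X<t = ∈-filter⁻ (disjoint? Y) {xs = G} X∈C in
      all-lookup (proj₂ (proj₁ (proj₂ adm))) X∈G , λ (_ , t≤X∩Y) → ≤⇒≯ (intersecting-sym X Y t≤X∩Y) Y∩X<t) ,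
    (λ X → mk⇔ (to X) (from X))
    where
    open Unpack adm
    C = filter (disjoint? Y) G
    K = suc (suc t * (n ∸ suc t))
    ∣C∣≡s : length C ≡ s
    ∣C∣≡s = ≤-antisym (all-head F-almost) (+-cancelʳ-≤ K s (length C) (begin
      s + K                                ≡⟨ +-comm s K ⟩
      L₁ n t s                             ≤⟨ L₁≤∣G∣ ⟩
      length G                             ≡⟨ numDisjoint+numIntersecting≡length Y G ⟨
      length C + numIntersecting Y G       ≤⟨ +-monoʳ-≤ (length C) (numIntersecting≤ Y (all-head F-sizes) G G-unique G-sizes) ⟩
      length C + K                         ∎))
      where open ≤-Reasoning
    to : ∀ X → X ∈ᶠ G → M₁ Y (t + 1) t X ⊎ X ∈ᶠ C
    to X X∈G with intersecting? Y X
    ... | yes Y∼X = inj₁ (all-lookup (proj₂ (proj₁ (proj₂ adm))) X∈G , intersecting-sym Y X Y∼X)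
    ... | no Y≁X = inj₂ (∈-filter⁺ (disjoint? Y) X∈G (≰⇒> Y≁X))
    from : ∀ X → M₁ Y (t + 1) t X ⊎ X ∈ᶠ C → X ∈ᶠ G
    from X (inj₁ (eX , X∼Y)) = maximal⇒∈ adm maximal (s≤s z≤n) X eX (intersecting-sym X Y X∼Y ∷ [])
    from X (inj₂ X∈C) = proj₁ (∈-filter⁻ (disjoint? Y) X∈C)

  Conclusion-ii : Family n → Family n → Set
  Conclusion-ii F G = ∃[ Z ] ∃[ W ] (∣ Z ∣ ≡ t + s + 2 × W ⊆ Z × ∣ W ∣ ≡ t ×
    (∀ X → (X ∈ᶠ F) ⇔ H₁ Z W (t + 1) X) ×
    ∃[ 𝓓 ] (Unique 𝓓 × length 𝓓 ≡ s + 2 ×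
      All (M₂ Z W t) 𝓓 ×
      (∀ i → i ∈ Z → i ∉ W → numContaining i 𝓓 ≡ 2) ×
      (∀ X → (X ∈ᶠ G) ⇔ (H₁ ⊤ W (t + 1) X ⊎ X ∈ᶠ 𝓓))))

  star-product≤L₂ : ∀ {F G} → Admissible n t s F G → StarConfiguration F G → length F * length G ≤ L₂ n t s
  star-product≤L₂ {F} {G} adm conf = begin
    length F * length G                                               ≡⟨ cong₂ _*_ (sym length-F) (length-containing+notContaining W G) ⟨
    (s + 2) * (length (containing W G) + length (notContaining W G))  ≤⟨ *-monoʳ-≤ (s + 2) (+-mono-≤ (length-containing≤ W ∣W∣≡t G G-unique G-sizes) length-notContaining≤) ⟩
    L₂ n t s                                                          ∎
    where
    open ≤-Reasoning
    open Unpack adm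
    open StarConfiguration conf

  module StarStructure {F G : Family n} (adm : Admissible n t s F G) (maximal : Maximal F G)
                       (conf : StarConfiguration F G) (L₂≤ : L₂ n t s ≤ length F * length G) where

    open Unpack adm
    open StarConfiguration conf

    Z : Subset n
    Z = W ∪ ⋃ F

    D : Family n
    D = notContaining W G

    W⊆ : ∀ {A} → A ∈ᶠ F → W ⊆ A
    W⊆ A∈ = proj₁ (all-lookup star A∈)

    ∣A∣≡suc∣W∣ : ∀ {A} → A ∈ᶠ F → ∣ A ∣ ≡ suc ∣ W ∣
    ∣A∣≡suc∣W∣ {A} A∈ = star-∣A∣≡suc∣W∣ W ∣W∣≡t A (proj₂ (all-lookup star A∈))

    ∣X∣≡suc∣W∣ : ∀ X → ∣ X ∣ ≡ t + 1 → ∣ X ∣ ≡ suc ∣ W ∣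
    ∣X∣≡suc∣W∣ X eX = star-∣A∣≡suc∣W∣ W ∣W∣≡t X (size-suc X eX)

    ∣Z∣≡t+s+2 : ∣ Z ∣ ≡ t + s + 2
    ∣Z∣≡t+s+2 = trans (∣W∪⋃star∣ W ∣W∣≡t F F-unique star) (trans (cong (t +_) length-F) (sym (+-assoc t s 2)))

    F-∈⇔ : ∀ X → (X ∈ᶠ F) ⇔ H₁ Z W (t + 1) X
    F-∈⇔ X = mk⇔ to from
      where
      to : X ∈ᶠ F → H₁ Z W (t + 1) X
      to X∈F = (λ x∈X → q⊆p∪q W (⋃ F) (⊆⋃ F X∈F x∈X)) , W⊆ X∈F , all-lookup (proj₂ (proj₁ adm)) X∈F
      from : H₁ Z W (t + 1) X → X ∈ᶠ F
      from (X⊆Z , W⊆X , eX) with x , x∈X , x∉W ← extension-new-point W X W⊆X (∣X∣≡suc∣W∣ X eX)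
                             with x∈p∪q⁻ W (⋃ F) (X⊆Z x∈X)
      ... | inj₁ x∈W = ⊥-elim (x∉W x∈W)
      ... | inj₂ x∈⋃F with A , A∈F , x∈A ← ∈⋃⁻ F x∈⋃F =
        subst (_∈ᶠ F) (sym (extension-injective W X A W⊆X (W⊆ A∈F) (∣X∣≡suc∣W∣ X eX) (∣A∣≡suc∣W∣ A∈F) x∈X x∈A x∉W)) A∈F

    G-∈⇔ : ∀ X → (X ∈ᶠ G) ⇔ (H₁ ⊤ W (t + 1) X ⊎ X ∈ᶠ D)
    G-∈⇔ X = mk⇔ to from
      where
      to : X ∈ᶠ G → H₁ ⊤ W (t + 1) X ⊎ X ∈ᶠ D
      to X∈G with W ⊆? X
      ... | yes W⊆X = inj₁ (⊆⊤ , W⊆X , all-lookup (proj₂ (proj₁ (proj₂ adm))) X∈G)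
      ... | no W⊈X = inj₂ (∈-filter⁺ (λ B → ¬? (W ⊆? B)) X∈G W⊈X)
      from : H₁ ⊤ W (t + 1) X ⊎ X ∈ᶠ D → X ∈ᶠ G
      from (inj₁ (_ , W⊆X , eX)) = maximal⇒∈ adm maximal (subst (0 <_) (sym length-F) 0<s+2) X eX
        (All.tabulate (λ A∈ → ⊆⇒intersecting ∣W∣≡t (W⊆ A∈) W⊆X))
      from (inj₂ X∈D) = proj₁ (∈-filter⁻ (λ B → ¬? (W ⊆? B)) X∈D)

    -- Maximality forces |𝓖| ≥ n − t + s + 2, while at most n − t members contain W.
    ∣D∣≡s+2 : length D ≡ s + 2
    ∣D∣≡s+2 = ≤-antisym length-notContaining≤ (+-cancelˡ-≤ (n ∸ t) (s + 2) (length D) (begin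
      n ∸ t + (s + 2)                          ≤⟨ *-cancelˡ-≤ (s + 2) {{>-nonZero 0<s+2}} (begin
                                                    L₂ n t s                                        ≤⟨ L₂≤ ⟩
                                                    length F * length G                             ≡⟨ cong₂ _*_ (sym length-F) (length-containing+notContaining W G) ⟨
                                                    (s + 2) * (length (containing W G) + length D)  ∎) ⟩
      length (containing W G) + length D       ≤⟨ +-monoˡ-≤ (length D) (length-containing≤ W ∣W∣≡t G G-unique G-sizes) ⟩
      n ∸ t + length D                         ∎))
      where open ≤-Reasoning

    D-unique : Unique D
    D-unique = UP.filter⁺ _ G-unique

    ∈D⁻ : ∀ {B} → B ∈ᶠ D → B ∈ᶠ G × ¬ (W ⊆ B)
    ∈D⁻ = ∈-filter⁻ (λ B → ¬? (W ⊆? B)) {xs = G}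

    ∣B∣≡suc-t : ∀ {B} → B ∈ᶠ D → ∣ B ∣ ≡ suc t
    ∣B∣≡suc-t B∈ = all-lookup G-sizes (proj₁ (∈D⁻ B∈))

    -- Every B ∈ D is t-disjoint from at least s = |𝓕| − 2 members of 𝓕 and every A ∈ 𝓕 from at
    -- most s members of D; as |𝓕| = |D|, double counting makes both bounds tight.
    numDisjoint-tight : All (λ A → numTDisjoint t A D ≡ s) F × All (λ B → numTDisjoint t B F ≡ s) D
    numDisjoint-tight =
      sum-map-≤-tight (λ A → numTDisjoint t A D) s F F-upper (begin
        length F * s                               ≡⟨ cong (_* s) (trans length-F (sym ∣D∣≡s+2)) ⟩
        length D * s                               ≤⟨ sum-map-≥ (λ B → numTDisjoint t B F) s D D-lower ⟩
        sum (map (λ B → numTDisjoint t B F) D)     ≡⟨ Σ-numDisjoint-comm F D ⟨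
        sum (map (λ A → numTDisjoint t A D) F)     ∎) ,
      sum-map-≥-tight (λ B → numTDisjoint t B F) s D D-lower (begin
        sum (map (λ B → numTDisjoint t B F) D)     ≡⟨ Σ-numDisjoint-comm F D ⟨
        sum (map (λ A → numTDisjoint t A D) F)     ≤⟨ sum-map-≤ (λ A → numTDisjoint t A D) s F F-upper ⟩
        length F * s                               ≡⟨ cong (_* s) (trans length-F (sym ∣D∣≡s+2)) ⟩
        length D * s                               ∎)
      where
      open ≤-Reasoning
      F-upper : All (λ A → numTDisjoint t A D ≤ s) F
      F-upper = All.map (λ {A} → ≤-trans (length-filter-filter≤ (disjoint? A) _ G)) F-almost
      D-lower : All (λ B → s ≤ numTDisjoint t B F) D
      D-lower = All.map (subst (_≤ _) (trans (cong (_∸ 2) length-F) (m+n∸n≡m s 2)))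
        (notContaining-numDisjoint≥ W ∣W∣≡t F G F-unique star G-sizes)

    numIntersecting-D≡2 : ∀ {B} → B ∈ᶠ D → numIntersecting B F ≡ 2
    numIntersecting-D≡2 {B} B∈ = +-cancelˡ-≡ s _ _ (begin
      s + numIntersecting B F                    ≡⟨ cong (_+ numIntersecting B F) (all-lookup (proj₂ numDisjoint-tight) B∈) ⟨
      numTDisjoint t B F + numIntersecting B F   ≡⟨ numDisjoint+numIntersecting≡length B F ⟩
      length F                                   ≡⟨ length-F ⟩
      s + 2                                      ∎)
      where open ≡-Reasoning

    numIntersecting-F≡2 : ∀ {A} → A ∈ᶠ F → numIntersecting A D ≡ 2
    numIntersecting-F≡2 {A} A∈ = +-cancelˡ-≡ s _ _ (begin
      s + numIntersecting A D                    ≡⟨ cong (_+ numIntersecting A D) (all-lookup (proj₁ numDisjoint-tight) A∈) ⟨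
      numTDisjoint t A D + numIntersecting A D   ≡⟨ numDisjoint+numIntersecting≡length A D ⟩
      length D                                   ≡⟨ ∣D∣≡s+2 ⟩
      s + 2                                      ∎)
      where open ≡-Reasoning

    B∩W<t : ∀ {B} → B ∈ᶠ D → ∣ B ∩ W ∣ < t
    B∩W<t {B} B∈ = subst (∣ B ∩ W ∣ <_) ∣W∣≡t (p⊈q⇒∣q∩p∣<∣p∣ W B (proj₂ (∈D⁻ B∈)))

    two-intersecting : ∀ {B} → B ∈ᶠ D →
      ∃[ A ] ∃[ A′ ] (A ∈ᶠ F × A′ ∈ᶠ F × A ≢ A′ × Intersecting B A × Intersecting B A′)
    two-intersecting {B} B∈
      with A , A′ , A∈ , A′∈ , A≢A′ ← 2≤length⇒distinct (filter (intersecting? B) F) (UP.filter⁺ _ F-unique)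
                                        (≤-reflexive (sym (numIntersecting-D≡2 B∈)))
      with A∈F , B∼A ← ∈-filter⁻ (intersecting? B) {xs = F} A∈
      with A′∈F , B∼A′ ← ∈-filter⁻ (intersecting? B) {xs = F} A′∈ = A , A′ , A∈F , A′∈F , A≢A′ , B∼A , B∼A′

    suc∣B∩W∣≡t : ∀ {B} → B ∈ᶠ D → suc ∣ B ∩ W ∣ ≡ t
    suc∣B∩W∣≡t {B} B∈ = let A , _ , A∈F , _ , _ , B∼A , _ = two-intersecting B∈ in
      ≤-antisym (B∩W<t B∈) (≤-trans B∼A (∣∩extension∣≤ W A B (W⊆ A∈F) (∣A∣≡suc∣W∣ A∈F)))

    ∩≡W : ∀ {A A′} → A ∈ᶠ F → A′ ∈ᶠ F → A ≢ A′ → A ∩ A′ ≡ W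
    ∩≡W {A} {A′} A∈ A′∈ A≢A′ = sym (p⊆q∧∣q∣≤∣p∣⇒p≡q W (A ∩ A′) (λ x∈W → ∈∩⁺ (W⊆ A∈ x∈W) (W⊆ A′∈ x∈W))
      (≤-reflexive (trans (distinct-intersecting⇒∣∩∣≡t (all-lookup F-sizes A∈) (all-lookup F-sizes A′∈) A≢A′
        (⊆⇒intersecting ∣W∣≡t (W⊆ A∈) (W⊆ A′∈))) (sym ∣W∣≡t))))

    -- B t-intersects two members A ≠ A′ of 𝓕 while ∣ B ∩ (A ∩ A′) ∣ = ∣ B ∩ W ∣ < t, so B ⊆ A ∪ A′.
    B⊆Z : ∀ {B} → B ∈ᶠ D → B ⊆ Z
    B⊆Z {B} B∈ x∈B =
      let A , A′ , A∈F , A′∈F , A≢A′ , B∼A , B∼A′ = two-intersecting B∈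
          B⊆A∪A′ = meets-both⇒⊆∪ A A′ B t (∣B∣≡suc-t B∈) B∼A B∼A′
                     (subst (λ C → ∣ B ∩ C ∣ < t) (sym (∩≡W A∈F A′∈F A≢A′)) (B∩W<t B∈))
      in q⊆p∪q W (⋃ F) ([ ⊆⋃ F A∈F , ⊆⋃ F A′∈F ]′ (x∈p∪q⁻ A A′ (B⊆A∪A′ x∈B)))

    D⊆M₂ : All (M₂ Z W t) D
    D⊆M₂ = All.tabulate λ B∈ → B⊆Z B∈ , all-lookup (proj₂ (proj₁ (proj₂ adm))) (proj₁ (∈D⁻ B∈)) ,
                                 cong (_∸ 1) (suc∣B∩W∣≡t B∈)

    -- For i ∈ A − W with A ∈ 𝓕, a member B of D contains i exactly when it t-intersects A.
    numContaining≡2 : ∀ i → i ∈ Z → i ∉ W → numContaining i D ≡ 2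
    numContaining≡2 i i∈Z i∉W with x∈p∪q⁻ W (⋃ F) i∈Z
    ... | inj₁ i∈W = ⊥-elim (i∉W i∈W)
    ... | inj₂ i∈⋃F with A , A∈F , i∈A ← ∈⋃⁻ F i∈⋃F =
      trans (length-filter-cong-on (i ∈?_) (intersecting? A) D contains⇒meets meets⇒contains) (numIntersecting-F≡2 A∈F)
      where
      contains⇒meets : ∀ {B} → B ∈ᶠ D → i ∈ B → Intersecting A B
      contains⇒meets {B} B∈ i∈B = intersecting-sym B A (subst (t ≤_)
        (sym (∣∩extension∣-new∈ W A B (W⊆ A∈F) (∣A∣≡suc∣W∣ A∈F) i∈A i∉W i∈B)) (≤-reflexive (sym (suc∣B∩W∣≡t B∈))))
      meets⇒contains : ∀ {B} → B ∈ᶠ D → Intersecting A B → i ∈ B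
      meets⇒contains {B} B∈ A∼B with i ∈? B
      ... | yes i∈B = i∈B
      ... | no i∉B = ⊥-elim (≤⇒≯ (subst (t ≤_) (∣∩extension∣-new∉ W A B (W⊆ A∈F) (∣A∣≡suc∣W∣ A∈F) i∈A i∉W i∉B)
                                    (intersecting-sym A B A∼B)) (B∩W<t B∈))

    conclusion : Conclusion-ii F G
    conclusion = Z , W , ∣Z∣≡t+s+2 , p⊆p∪q (⋃ F) , ∣W∣≡t , F-∈⇔ ,
                 D , D-unique , ∣D∣≡s+2 , D⊆M₂ , numContaining≡2 , G-∈⇔
initial : (n k : ℕ) → Subset n
initial zero _ = []
initial (suc n) zero = false ∷ initial n zero
initial (suc n) (suc k) = true ∷ initial n k

∣initial∣ : (n k : ℕ) → k ≤ n → ∣ initial n k ∣ ≡ k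
∣initial∣ zero zero _ = refl
∣initial∣ (suc n) zero _ = ∣initial∣ n zero z≤n
∣initial∣ (suc n) (suc k) (s≤s h) = cong suc (∣initial∣ n k h)

initial-∈⁺ : (n k : ℕ) (i : Fin n) → toℕ i < k → i ∈ initial n k
initial-∈⁺ (suc n) (suc k) zero _ = here
initial-∈⁺ (suc n) (suc k) (suc i) (s≤s h) = there (initial-∈⁺ n k i h)

initial-∈⁻ : (n k : ℕ) (i : Fin n) → i ∈ initial n k → toℕ i < k
initial-∈⁻ (suc n) zero (suc i) (there m) with initial-∈⁻ n zero i m
... | ()
initial-∈⁻ (suc n) (suc k) zero _ = s≤s z≤n
initial-∈⁻ (suc n) (suc k) (suc i) (there m) = s≤s (initial-∈⁻ n k i m)

-- pt j is the j-th point of Fin n; the junk value pt j = pt 0 for j ≥ n is never used.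
module Points (n : ℕ) (n>0 : 0 < n) where

  pt : ℕ → Fin n
  pt j with j <? n
  ... | yes p = fromℕ< p
  ... | no _ = fromℕ< n>0

  toℕ-pt : ∀ j → j < n → toℕ (pt j) ≡ j
  toℕ-pt j h with j <? n
  ... | yes p = toℕ-fromℕ< p
  ... | no np = ⊥-elim (np h)

  pt-injective : ∀ {i j} → i < n → j < n → pt i ≡ pt j → i ≡ j
  pt-injective {i} {j} hi hj e = trans (sym (toℕ-pt i hi)) (trans (cong toℕ e) (toℕ-pt j hj))

  pt-≢ : ∀ {i j} → i < n → j < n → i ≢ j → pt i ≢ pt j
  pt-≢ hi hj ne e = ne (pt-injective hi hj e)

  pt∈initial : ∀ {j k} → j < n → j < k → pt j ∈ initial n k
  pt∈initial {j} {k} hj jk = initial-∈⁺ n k (pt j) (subst (_< k) (sym (toℕ-pt j hj)) jk)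

  pt∉initial : ∀ {j k} → j < n → k ≤ j → pt j ∉ initial n k
  pt∉initial {j} {k} hj kj m = <⇒≱ (subst (_< k) (toℕ-pt j hj) (initial-∈⁻ n k (pt j) m)) kj

-- Configuration (i): 𝓕 = {Y} for Y = {0, …, t}; 𝓖 consists of Y, its (t + 1)(n − t − 1)
-- neighbours (Y − a) ∪ {x}, and s far sets {c, y j} ∪ (Y − {a₀, a₁}) meeting Y in t − 1 points.
module ConfigurationI (n t s : ℕ) (t≥1 : 1 ≤ t) (s≥1 : 1 ≤ s) (t+[s+2]≤n : t + (s + 2) ≤ n) where

  open TIntersection n t

  room : suc (suc t) + s ≤ n
  room = subst (_≤ n) (t+[s+2]≡ t s) t+[s+2]≤n
    where
    t+[s+2]≡ : ∀ t s → t + (s + 2) ≡ suc (suc t) + s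
    t+[s+2]≡ = solve-∀

  n>0 : 0 < n
  n>0 = ≤-trans (s≤s z≤n) room
  open Points n n>0

  Y : Subset n
  Y = initial n (suc t)
  ∣Y∣≡suc-t : ∣ Y ∣ ≡ suc t
  ∣Y∣≡suc-t = ∣initial∣ n (suc t) (≤-trans (n≤1+n (suc t)) (≤-trans (m≤m+n (suc (suc t)) s) room))

  a₀ a₁ c : Fin n
  a₀ = pt 0
  a₁ = pt 1
  c = pt (suc t)
  y : ℕ → Fin n
  y j = pt (suc (suc t) + j)

  0<n : 0 < n
  0<n = n>0
  1<n : 1 < n
  1<n = ≤-trans (s≤s (s≤s z≤n)) room
  t+1<n : suc t < n
  t+1<n = ≤-trans (m≤m+n (suc (suc t)) s) room
  t+2+j<n : ∀ {j} → j < s → suc (suc t) + j < n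
  t+2+j<n h = ≤-trans (+-monoʳ-< (suc (suc t)) h) room

  a₀∈Y : a₀ ∈ Y
  a₀∈Y = pt∈initial 0<n (s≤s z≤n)
  a₁∈Y : a₁ ∈ Y
  a₁∈Y = pt∈initial 1<n (s≤s t≥1)
  c∉Y : c ∉ Y
  c∉Y = pt∉initial t+1<n ≤-refl
  y∉Y : ∀ {j} → j < s → y j ∉ Y
  y∉Y h = pt∉initial (t+2+j<n h) (≤-trans (n≤1+n (suc t)) (m≤m+n (suc (suc t)) _))

  V : Subset n
  V = (Y - a₀) - a₁
  suc∣V∣≡t : suc ∣ V ∣ ≡ t
  suc∣V∣≡t = trans (x∈p⇒suc∣p-x∣≡∣p∣ (Y - a₀) {a₁} (x∈p∧x≢y⇒x∈p-y {y = a₀} a₁∈Y (pt-≢ 1<n 0<n (λ ())))) (suc-injective (trans (x∈p⇒suc∣p-x∣≡∣p∣ Y a₀∈Y) ∣Y∣≡suc-t))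
  V⊆Y : V ⊆ Y
  V⊆Y m = p-x⊆p Y a₀ (p-x⊆p (Y - a₀) a₁ m)

  neighbour : Fin n × Fin n → Subset n
  neighbour (a , x) = ⁅ x ⁆ ∪ (Y - a)

  neighbourCodes : List (Fin n × Fin n)
  neighbourCodes = cartesianProduct (elements Y) (elements (∁ Y))
  neighbours : Family n
  neighbours = map neighbour neighbourCodes

  ∈neighbours⁻ : ∀ {B} → B ∈ᶠ neighbours → ∃[ a ] ∃[ x ] (a ∈ Y × x ∉ Y × B ≡ neighbour (a , x))
  ∈neighbours⁻ m with ∈-map⁻ neighbour m
  ... | (a , x) , mc , refl with ∈-cartesianProduct⁻ (elements Y) (elements (∁ Y)) mc
  ... | ma , mx = a , x , ∈-elements⁻ Y ma , x∈∁p⇒x∉p (∈-elements⁻ (∁ Y) mx) , refl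

  ∣neighbour∣≡suc-t : ∀ {a x} → a ∈ Y → x ∉ Y → ∣ neighbour (a , x) ∣ ≡ suc t
  ∣neighbour∣≡suc-t {a} {x} aY xY = trans (x∉p⇒∣⁅x⁆∪p∣≡suc∣p∣ (Y - a) (λ m → xY (p-x⊆p Y a m))) (trans (x∈p⇒suc∣p-x∣≡∣p∣ Y aY) ∣Y∣≡suc-t)

  Y∼neighbour : ∀ {a x} → a ∈ Y → x ∉ Y → Intersecting Y (neighbour (a , x))
  Y∼neighbour {a} {x} aY xY = subst (_≤ ∣ Y ∩ neighbour (a , x) ∣) (suc-injective (trans (x∈p⇒suc∣p-x∣≡∣p∣ Y aY) ∣Y∣≡suc-t))
    (p⊆q⇒∣p∣≤∣q∣ (λ m → ∈∩⁺ (p-x⊆p Y a m) (p⊆⁅x⁆∪p x (Y - a) m)))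

  a∉neighbour : ∀ {a x} → a ∈ Y → x ∉ Y → a ∉ neighbour (a , x)
  a∉neighbour {a} {x} aY xY m with ∈⁅x⁆∪p⁻ m
  ... | inj₁ refl = xY aY
  ... | inj₂ m' = x∉p-x Y a m'

  neighbour-injective : ∀ {p q} → p ∈ᶠ neighbourCodes → q ∈ᶠ neighbourCodes → neighbour p ≡ neighbour q → p ≡ q
  neighbour-injective {a , x} {a' , x'} mp mq e with ∈-cartesianProduct⁻ (elements Y) (elements (∁ Y)) mp | ∈-cartesianProduct⁻ (elements Y) (elements (∁ Y)) mq
  ... | ma , mx | ma' , mx' = cong₂ _,_ aa xx
    where
    aY = ∈-elements⁻ Y ma
    aY' = ∈-elements⁻ Y ma'
    xY = x∈∁p⇒x∉p (∈-elements⁻ (∁ Y) mx)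
    xY' = x∈∁p⇒x∉p (∈-elements⁻ (∁ Y) mx')
    aa : a ≡ a'
    aa with a Fin.≟ a'
    ... | yes e' = e'
    ... | no ne = ⊥-elim (a∉neighbour aY xY (subst (a ∈_) (sym e) (p⊆⁅x⁆∪p x' (Y - a') (x∈p∧x≢y⇒x∈p-y aY ne))))
    xx : x ≡ x'
    xx with ∈⁅x⁆∪p⁻ (subst (x ∈_) e (x∈⁅x⁆∪p x (Y - a)))
    ... | inj₁ e' = e'
    ... | inj₂ m = ⊥-elim (xY (p-x⊆p Y a' m))

  neighbours-unique : Unique neighbours
  neighbours-unique = unique-map⁺ neighbour (UP.cartesianProduct⁺ (elements-unique Y) (elements-unique (∁ Y))) neighbour-injective

  far : ℕ → Subset n
  far j = ⁅ c ⁆ ∪ (⁅ y j ⁆ ∪ V)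

  farSets : Family n
  farSets = map far (upTo s)

  ∈farSets⁻ : ∀ {B} → B ∈ᶠ farSets → ∃[ j ] (j < s × B ≡ far j)
  ∈farSets⁻ m with ∈-map⁻ far m
  ... | j , mj , refl = j , ∈-upTo⁻ mj , refl

  ∣far∣≡suc-t : ∀ {j} → j < s → ∣ far j ∣ ≡ suc t
  ∣far∣≡suc-t {j} h = trans (x∉p⇒∣⁅x⁆∪p∣≡suc∣p∣ _ cnot) (cong suc (trans (x∉p⇒∣⁅x⁆∪p∣≡suc∣p∣ V (λ m → y∉Y h (V⊆Y m))) suc∣V∣≡t))
    where
    cnot : c ∉ ⁅ y j ⁆ ∪ V
    cnot m with ∈⁅x⁆∪p⁻ m
    ... | inj₁ e = <-irrefl refl (subst (suc t <_) (sym (pt-injective t+1<n (t+2+j<n h) e)) (s≤s (m≤m+n (suc t) j)))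
    ... | inj₂ m' = c∉Y (V⊆Y m')

  ∣Y∩far∣<t : ∀ {j} → j < s → ∣ Y ∩ far j ∣ < t
  ∣Y∩far∣<t {j} h = subst (∣ Y ∩ far j ∣ <_) suc∣V∣≡t (s≤s (p⊆q⇒∣p∣≤∣q∣ sub))
    where
    sub : Y ∩ far j ⊆ V
    sub {z} m with ∈⁅x⁆∪p⁻ (p∩q⊆q Y (far j) m)
    ... | inj₁ refl = ⊥-elim (c∉Y (p∩q⊆p Y _ m))
    ... | inj₂ m' with ∈⁅x⁆∪p⁻ m'
    ...   | inj₁ refl = ⊥-elim (y∉Y h (p∩q⊆p Y _ m))
    ...   | inj₂ m'' = m''

  far-injective : ∀ {i j} → i ∈ᶠ upTo s → j ∈ᶠ upTo s → far i ≡ far j → i ≡ j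
  far-injective {i} {j} mi mj e with ∈⁅x⁆∪p⁻ (subst (y i ∈_) e (x∈p∪q⁺ (inj₂ (x∈⁅x⁆∪p (y i) V))))
  ... | inj₁ e' = ⊥-elim (<-irrefl refl (subst (suc t <_) (pt-injective (t+2+j<n hi) t+1<n e') (s≤s (s≤s (m≤m+n t _)))))
    where hi = ∈-upTo⁻ mi
  ... | inj₂ m with ∈⁅x⁆∪p⁻ m
  ...   | inj₁ e' = +-cancelˡ-≡ (suc (suc t)) _ _ (pt-injective (t+2+j<n (∈-upTo⁻ mi)) (t+2+j<n (∈-upTo⁻ mj)) e')
  ...   | inj₂ m' = ⊥-elim (y∉Y (∈-upTo⁻ mi) (V⊆Y m'))

  farSets-unique : Unique farSets
  farSets-unique = unique-map⁺ far (UP.upTo⁺ s) far-injective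

  G₀ : Family n
  G₀ = Y ∷ (neighbours ++ farSets)

  Y∼neighbours : ∀ {B} → B ∈ᶠ neighbours → Intersecting Y B
  Y∼neighbours m = let (a , x , aY , xY , e) = ∈neighbours⁻ m in subst (Intersecting Y) (sym e) (Y∼neighbour aY xY)

  Y≁farSets : ∀ {B} → B ∈ᶠ farSets → ∣ Y ∩ B ∣ < t
  Y≁farSets m = let (j , h , e) = ∈farSets⁻ m in subst (λ z → ∣ Y ∩ z ∣ < t) (sym e) (∣Y∩far∣<t h)

  Y∼Y : Intersecting Y Y
  Y∼Y = intersecting-refl {Y} ∣Y∣≡suc-t

  G₀-unique : Unique G₀
  G₀-unique = All.tabulate (λ {B} m → ne m) ∷ UP.++⁺ neighbours-unique farSets-unique disj
    where
    ne : ∀ {B} → B ∈ᶠ neighbours ++ farSets → Y ≢ B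
    ne m refl with ∈-++⁻ neighbours m
    ... | inj₁ mN = let (a , x , aY , xY , e) = ∈neighbours⁻ mN in a∉neighbour aY xY (subst (a ∈_) e aY)
    ... | inj₂ mC = <⇒≱ (Y≁farSets mC) Y∼Y
    disj : ∀ {v} → ¬ (v ∈ᶠ neighbours × v ∈ᶠ farSets)
    disj (mN , mC) = <⇒≱ (Y≁farSets mC) (Y∼neighbours mN)

  G₀-sizes : All (λ X → ∣ X ∣ ≡ t + 1) G₀
  G₀-sizes = All.tabulate λ m → trans (size m) (+-comm 1 t)
    where
    size : ∀ {B} → B ∈ᶠ G₀ → ∣ B ∣ ≡ suc t
    size (here refl) = ∣Y∣≡suc-t
    size (there m) with ∈-++⁻ neighbours m
    ... | inj₁ mN = let (a , x , aY , xY , e) = ∈neighbours⁻ mN in subst (λ z → ∣ z ∣ ≡ suc t) (sym e) (∣neighbour∣≡suc-t aY xY)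
    ... | inj₂ mC = let (j , h , e) = ∈farSets⁻ mC in subst (λ z → ∣ z ∣ ≡ suc t) (sym e) (∣far∣≡suc-t h)

  length-farSets : length farSets ≡ s
  length-farSets = trans (length-map far (upTo s)) (length-applyUpTo (λ i → i) s)

  numDisjoint-Y≤s : numTDisjoint t Y G₀ ≤ s
  numDisjoint-Y≤s = begin
    numTDisjoint t Y G₀                                                  ≡⟨ cong length (filter-reject (disjoint? Y) (≤⇒≯ Y∼Y)) ⟩
    length (filter (disjoint? Y) (neighbours ++ farSets))                              ≡⟨ cong length (filter-++ (disjoint? Y) neighbours farSets) ⟩
    length (filter (disjoint? Y) neighbours ++ filter (disjoint? Y) farSets)          ≡⟨ length-++ (filter (disjoint? Y) neighbours) ⟩
    length (filter (disjoint? Y) neighbours) + length (filter (disjoint? Y) farSets)  ≡⟨ cong (λ xs → length xs + length (filter (disjoint? Y) farSets))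
                                                                                (filter-none (disjoint? Y) (All.tabulate (λ m → ≤⇒≯ (Y∼neighbours m)))) ⟩
    length (filter (disjoint? Y) farSets)                                     ≤⟨ length-filter (disjoint? Y) farSets ⟩
    length farSets                                                             ≡⟨ length-farSets ⟩
    s                                                                     ∎
    where open ≤-Reasoning

  admissible : Admissible n t s (Y ∷ []) G₀
  admissible =
    ((([] ∷ []) , (trans ∣Y∣≡suc-t (+-comm 1 t) ∷ [])) ,
    (G₀-unique , G₀-sizes) ,
    ((numDisjoint-Y≤s ∷ []) , All.tabulate (λ {B} _ → ≤-trans (length-filter (disjoint? B) (Y ∷ [])) s≥1)) ,
    ncross ,
    s≤s z≤n)
    where
    c0∈ : far 0 ∈ᶠ G₀
    c0∈ = there (∈-++⁺ʳ neighbours (∈-map⁺ far (∈-upTo⁺ s≥1)))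
    ncross : ¬ CrossTIntersecting t (Y ∷ []) G₀
    ncross (h ∷ []) = <⇒≱ (∣Y∩far∣<t s≥1) (all-lookup h c0∈)

  product≡L₁ : length (Y ∷ []) * length G₀ ≡ L₁ n t s
  product≡L₁ = trans (+-identityʳ (length G₀)) (cong suc length-neighbours++farSets)
    where
    length-neighbours : length neighbours ≡ suc t * (n ∸ suc t)
    length-neighbours = trans (length-map neighbour neighbourCodes) (trans (length-cartesianProduct (elements Y) (elements (∁ Y)))
      (cong₂ _*_ (trans (length-elements Y) ∣Y∣≡suc-t) (trans (length-elements (∁ Y)) (trans (∣∁p∣≡n∸∣p∣ Y) (cong (n ∸_) ∣Y∣≡suc-t)))))
    length-neighbours++farSets : length (neighbours ++ farSets) ≡ suc t * (n ∸ suc t) + s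
    length-neighbours++farSets = trans (length-++ neighbours) (cong₂ _+_ length-neighbours length-farSets)

-- Configuration (ii): W = {0, …, t − 1} and points x 0, …, x (s + 1) outside W; 𝓕 is the s + 2
-- petals W ∪ {x i}, and 𝓖 is the full star {W ∪ {z}} together with the s + 2 links
-- (W − w₀) ∪ {x j, x (j + 1 mod s + 2)}, each t-intersecting exactly two petals.
module ConfigurationII (n t s : ℕ) (t≥1 : 1 ≤ t) (s≥1 : 1 ≤ s) (room : t + (s + 2) ≤ n) where

  open TIntersection n t

  k : ℕ
  k = s + 2

  k≥3 : 3 ≤ k
  k≥3 = subst (3 ≤_) (+-comm 2 s) (s≤s (s≤s s≥1))

  n>0 : 0 < n
  n>0 = ≤-trans t≥1 (≤-trans (m≤m+n t (s + 2)) room)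
  open Points n n>0

  t+j<n : ∀ {j} → j < k → t + j < n
  t+j<n h = ≤-trans (+-monoʳ-< t h) room

  x : ℕ → Fin n
  x j = pt (t + j)

  W : Subset n
  W = initial n t
  ∣W∣≡t : ∣ W ∣ ≡ t
  ∣W∣≡t = ∣initial∣ n t (≤-trans (m≤m+n t (s + 2)) room)
  w₀ : Fin n
  w₀ = pt 0
  w₀∈W : w₀ ∈ W
  w₀∈W = pt∈initial n>0 t≥1
  V : Subset n
  V = W - w₀
  suc∣V∣≡t : suc ∣ V ∣ ≡ t
  suc∣V∣≡t = trans (x∈p⇒suc∣p-x∣≡∣p∣ W w₀∈W) ∣W∣≡t
  V⊆W : V ⊆ W
  V⊆W = p-x⊆p W w₀

  x∉W : ∀ {j} → j < k → x j ∉ W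
  x∉W h = pt∉initial (t+j<n h) (m≤m+n t _)

  x-injective : ∀ {i j} → i < k → j < k → x i ≡ x j → i ≡ j
  x-injective hi hj e = +-cancelˡ-≡ t _ _ (pt-injective (t+j<n hi) (t+j<n hj) e)

  next : ℕ → ℕ
  next j with suc j ≟ k
  ... | yes _ = 0
  ... | no _ = suc j

  next<k : ∀ {j} → j < k → next j < k
  next<k {j} h with suc j ≟ k
  ... | yes _ = ≤-trans (s≤s z≤n) h
  ... | no ne = ≤∧≢⇒< h ne

  next-suc : ∀ {j} → suc j < k → next j ≡ suc j
  next-suc {j} h with suc j ≟ k
  ... | yes e = ⊥-elim (<-irrefl e h)
  ... | no _ = refl

  next-last : next (s + 1) ≡ 0
  next-last with suc (s + 1) ≟ k
  ... | yes _ = refl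
  ... | no ne = ⊥-elim (ne (sym (+-suc s 1)))

  next≢ : ∀ {j} → j < k → next j ≢ j
  next≢ {j} h with suc j ≟ k
  ... | yes e = λ next≡j → <⇒≱ (subst (_< 3) (trans (cong suc next≡j) e) (s≤s (s≤s z≤n))) k≥3
  ... | no _ = λ e → <-irrefl (sym e) ≤-refl

  next-injective : ∀ {i j} → i < k → j < k → next i ≡ next j → i ≡ j
  next-injective {i} {j} hi hj e with suc i ≟ k | suc j ≟ k
  ... | yes ei | yes ej = suc-injective (trans ei (sym ej))
  ... | yes _ | no _ = ⊥-elim (0≢1+n e)
  ... | no _ | yes _ = ⊥-elim (0≢1+n (sym e))
  ... | no _ | no _ = suc-injective e

  next-top : ∀ {j} → suc j ≡ k → next j ≡ 0
  next-top {j} e with suc j ≟ k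
  ... | yes _ = refl
  ... | no ne = ⊥-elim (ne e)

  next²≢ : ∀ {j} → j < k → next (next j) ≢ j
  next²≢ {j} h e with m≤n⇒m<n∨m≡n h
  ... | inj₂ ej = <-irrefl (trans (cong suc e1) ej) k≥3
    where
    e1 : 1 ≡ j
    e1 = trans (sym (trans (cong next (next-top ej)) (next-suc {0} (≤-trans (s≤s (s≤s z≤n)) k≥3)))) e
  ... | inj₁ lt with m≤n⇒m<n∨m≡n lt
  ...   | inj₂ ek = <-irrefl (trans (cong (λ q → suc (suc q)) e0) ek) k≥3
    where
    e0 : 0 ≡ j
    e0 = trans (sym (trans (cong next (next-suc lt)) (next-top ek))) e
  ...   | inj₁ lt2 = <-irrefl (sym (trans (sym (trans (cong next (next-suc lt)) (next-suc lt2))) e)) (<-trans (n<1+n j) (n<1+n (suc j)))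

  prev : ℕ → ℕ
  prev zero = s + 1
  prev (suc i) = i

  prev<k : ∀ {i} → i < k → prev i < k
  prev<k {zero} _ = subst (s + 1 <_) refl (+-monoʳ-< s ≤-refl)
  prev<k {suc i} h = <-trans (n<1+n i) h

  next∘prev : ∀ {i} → i < k → next (prev i) ≡ i
  next∘prev {zero} _ = next-last
  next∘prev {suc i} h = next-suc h

  prev≢ : ∀ {i} → i < k → prev i ≢ i
  prev≢ {i} h e = next≢ (prev<k h) (trans (next∘prev h) (sym e))

  petal : ℕ → Subset n
  petal i = ⁅ x i ⁆ ∪ W

  link : ℕ → Subset n
  link j = ⁅ x j ⁆ ∪ (⁅ x (next j) ⁆ ∪ V)

  starSet : Fin n → Subset n
  starSet z = ⁅ z ⁆ ∪ W

  ∣petal∣≡suc-t : ∀ {i} → i < k → ∣ petal i ∣ ≡ suc t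
  ∣petal∣≡suc-t h = trans (x∉p⇒∣⁅x⁆∪p∣≡suc∣p∣ W (x∉W h)) (cong suc ∣W∣≡t)

  ∣link∣≡suc-t : ∀ {j} → j < k → ∣ link j ∣ ≡ suc t
  ∣link∣≡suc-t {j} h = trans (x∉p⇒∣⁅x⁆∪p∣≡suc∣p∣ _ nin) (cong suc (trans (x∉p⇒∣⁅x⁆∪p∣≡suc∣p∣ V (λ m → x∉W (next<k h) (V⊆W m))) suc∣V∣≡t))
    where
    nin : x j ∉ ⁅ x (next j) ⁆ ∪ V
    nin m with ∈⁅x⁆∪p⁻ m
    ... | inj₁ e = next≢ h (sym (x-injective h (next<k h) e))
    ... | inj₂ m' = x∉W h (V⊆W m')

  w₀∉link : ∀ {j} → j < k → w₀ ∉ link j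
  w₀∉link {j} h m with ∈⁅x⁆∪p⁻ m
  ... | inj₁ e = <-irrefl (pt-injective n>0 (t+j<n h) e) (≤-trans t≥1 (m≤m+n t j))
  ... | inj₂ m' with ∈⁅x⁆∪p⁻ m'
  ...   | inj₁ e = <-irrefl (pt-injective n>0 (t+j<n (next<k h)) e) (≤-trans t≥1 (m≤m+n t _))
  ...   | inj₂ m'' = x∉p-x W w₀ m''

  petal∼link : ∀ {i j} → i < k → j < k → i ≡ j ⊎ i ≡ next j → Intersecting (petal i) (link j)
  petal∼link {i} {j} hi hj c = subst (_≤ ∣ petal i ∩ link j ∣) (trans (x∉p⇒∣⁅x⁆∪p∣≡suc∣p∣ V (λ m → x∉W hi (V⊆W m))) suc∣V∣≡t)
    (p⊆q⇒∣p∣≤∣q∣ (⁅x⁆∪p⊆q (∈∩⁺ (x∈⁅x⁆∪p (x i) W) xiE) (λ m → ∈∩⁺ (p⊆⁅x⁆∪p (x i) W (V⊆W m)) (p⊆⁅x⁆∪p (x j) _ (p⊆⁅x⁆∪p _ V m)))))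
    where
    xiE' : i ≡ j ⊎ i ≡ next j → x i ∈ link j
    xiE' (inj₁ refl) = x∈⁅x⁆∪p (x i) _
    xiE' (inj₂ refl) = p⊆⁅x⁆∪p (x j) _ (x∈⁅x⁆∪p _ V)
    xiE = xiE' c

  petal≁link : ∀ {i j} → i < k → j < k → i ≢ j → i ≢ next j → ∣ petal i ∩ link j ∣ < t
  petal≁link {i} {j} hi hj n1 n2 = subst (∣ petal i ∩ link j ∣ <_) suc∣V∣≡t (s≤s (p⊆q⇒∣p∣≤∣q∣ sub))
    where
    sub : petal i ∩ link j ⊆ V
    sub {z} m with ∈⁅x⁆∪p⁻ (p∩q⊆q (petal i) (link j) m)
    ... | inj₁ refl with ∈⁅x⁆∪p⁻ (p∩q⊆p (petal i) (link j) m)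
    ...   | inj₁ e = ⊥-elim (n1 (sym (x-injective hj hi e)))
    ...   | inj₂ zW = ⊥-elim (x∉W hj zW)
    sub {z} m | inj₂ m' with ∈⁅x⁆∪p⁻ m'
    ...   | inj₂ zV = zV
    ...   | inj₁ refl with ∈⁅x⁆∪p⁻ (p∩q⊆p (petal i) (link j) m)
    ...     | inj₁ e = ⊥-elim (n2 (sym (x-injective (next<k hj) hi e)))
    ...     | inj₂ zW = ⊥-elim (x∉W (next<k hj) zW)

  petal-injective : ∀ {i i'} → i < k → i' < k → petal i ≡ petal i' → i ≡ i'
  petal-injective {i} {i'} h h' e with ∈⁅x⁆∪p⁻ (subst (x i ∈_) e (x∈⁅x⁆∪p (x i) W))
  ... | inj₁ e' = x-injective h h' e'
  ... | inj₂ m = ⊥-elim (x∉W h m)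

  link-injective : ∀ {j j'} → j < k → j' < k → link j ≡ link j' → j ≡ j'
  link-injective {j} {j'} h h' e = go (where-x (x∈⁅x⁆∪p (x j) _) h refl) (where-x (p⊆⁅x⁆∪p (x j) _ (x∈⁅x⁆∪p _ V)) (next<k h) refl)
    where
    where-x : ∀ {z} → z ∈ link j → ∀ {q} → q < k → z ≡ x q → q ≡ j' ⊎ q ≡ next j'
    where-x {z} m {q} hq refl with ∈⁅x⁆∪p⁻ (subst (x q ∈_) e m)
    ... | inj₁ e' = inj₁ (x-injective hq h' e')
    ... | inj₂ m' with ∈⁅x⁆∪p⁻ m'
    ...   | inj₁ e' = inj₂ (x-injective hq (next<k h') e')
    ...   | inj₂ mV = ⊥-elim (x∉W hq (V⊆W mV))
    go : j ≡ j' ⊎ j ≡ next j' → next j ≡ j' ⊎ next j ≡ next j' → j ≡ j'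
    go (inj₁ e1) _ = e1
    go (inj₂ e1) (inj₂ e2) = next-injective h h' e2
    go (inj₂ e1) (inj₁ e2) = ⊥-elim (next²≢ h' (trans (cong next (sym e1)) e2))

  petals starSets links : Family n
  petals = map petal (upTo k)
  starSets = map starSet (elements (∁ W))
  links = map link (upTo k)

  G₀ : Family n
  G₀ = starSets ++ links

  ∈petals⁻ : ∀ {B} → B ∈ᶠ petals → ∃[ i ] (i < k × B ≡ petal i)
  ∈petals⁻ m with ∈-map⁻ petal m
  ... | i , mi , refl = i , ∈-upTo⁻ mi , refl

  ∈links⁻ : ∀ {B} → B ∈ᶠ links → ∃[ j ] (j < k × B ≡ link j)
  ∈links⁻ m with ∈-map⁻ link m
  ... | j , mj , refl = j , ∈-upTo⁻ mj , refl

  ∈starSets⁻ : ∀ {B} → B ∈ᶠ starSets → ∃[ z ] (z ∉ W × B ≡ starSet z)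
  ∈starSets⁻ m with ∈-map⁻ starSet m
  ... | z , mz , refl = z , x∈∁p⇒x∉p (∈-elements⁻ (∁ W) mz) , refl

  petal∈petals : ∀ {i} → i < k → petal i ∈ᶠ petals
  petal∈petals h = ∈-map⁺ petal (∈-upTo⁺ h)

  link∈links : ∀ {j} → j < k → link j ∈ᶠ links
  link∈links h = ∈-map⁺ link (∈-upTo⁺ h)

  length-petals : length petals ≡ k
  length-petals = trans (length-map petal (upTo k)) (length-applyUpTo (λ i → i) k)

  length-links : length links ≡ k
  length-links = trans (length-map link (upTo k)) (length-applyUpTo (λ i → i) k)

  length-starSets : length starSets ≡ n ∸ t
  length-starSets = trans (length-map starSet (elements (∁ W))) (trans (length-elements (∁ W)) (trans (∣∁p∣≡n∸∣p∣ W) (cong (n ∸_) ∣W∣≡t)))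

  petals-unique : Unique petals
  petals-unique = unique-map⁺ petal (UP.upTo⁺ k) (λ mi mi' e → petal-injective (∈-upTo⁻ mi) (∈-upTo⁻ mi') e)

  links-unique : Unique links
  links-unique = unique-map⁺ link (UP.upTo⁺ k) (λ mi mi' e → link-injective (∈-upTo⁻ mi) (∈-upTo⁻ mi') e)

  starSets-unique : Unique starSets
  starSets-unique = unique-map⁺ starSet (elements-unique (∁ W)) inj
    where
    inj : ∀ {z z'} → z ∈ᶠ elements (∁ W) → z' ∈ᶠ elements (∁ W) → starSet z ≡ starSet z' → z ≡ z'
    inj {z} {z'} m m' e with ∈⁅x⁆∪p⁻ (subst (z ∈_) e (x∈⁅x⁆∪p z W))
    ... | inj₁ e' = e'
    ... | inj₂ zW = ⊥-elim (x∈∁p⇒x∉p (∈-elements⁻ (∁ W) m) zW)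

  G₀-unique : Unique G₀
  G₀-unique = UP.++⁺ starSets-unique links-unique disj
    where
    disj : ∀ {v} → ¬ (v ∈ᶠ starSets × v ∈ᶠ links)
    disj (mS , mD) with ∈starSets⁻ mS | ∈links⁻ mD
    ... | z , _ , e1 | j , h , e2 = w₀∉link h (subst (w₀ ∈_) (trans (sym e1) e2) (p⊆⁅x⁆∪p z W w₀∈W))

  petals-sizes : All (λ X → ∣ X ∣ ≡ t + 1) petals
  petals-sizes = All.tabulate λ m → let (i , h , e) = ∈petals⁻ m in trans (subst (λ z → ∣ z ∣ ≡ suc t) (sym e) (∣petal∣≡suc-t h)) (+-comm 1 t)

  G₀-sizes : All (λ X → ∣ X ∣ ≡ t + 1) G₀
  G₀-sizes = All.tabulate λ m → trans (size m) (+-comm 1 t)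
    where
    size : ∀ {B} → B ∈ᶠ G₀ → ∣ B ∣ ≡ suc t
    size m with ∈-++⁻ starSets m
    ... | inj₁ mS = let (z , zW , e) = ∈starSets⁻ mS in subst (λ q → ∣ q ∣ ≡ suc t) (sym e) (trans (x∉p⇒∣⁅x⁆∪p∣≡suc∣p∣ W zW) (cong suc ∣W∣≡t))
    ... | inj₂ mD = let (j , h , e) = ∈links⁻ mD in subst (λ q → ∣ q ∣ ≡ suc t) (sym e) (∣link∣≡suc-t h)

  numDisjoint≤s : ∀ X Xs → length Xs ≡ s + 2 → ∀ {B B′} → B ∈ᶠ Xs → B′ ∈ᶠ Xs → B ≢ B′ →
    Intersecting X B → Intersecting X B′ → numTDisjoint t X Xs ≤ s
  numDisjoint≤s X Xs ∣Xs∣≡s+2 B∈ B′∈ B≢B′ X∼B X∼B′ = +-cancelʳ-≤ 2 (numTDisjoint t X Xs) s (begin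
    numTDisjoint t X Xs + 2                     ≤⟨ +-monoʳ-≤ _ (2≤length-filter (intersecting? X) B∈ B′∈ B≢B′ X∼B X∼B′) ⟩
    numTDisjoint t X Xs + numIntersecting X Xs  ≡⟨ numDisjoint+numIntersecting≡length X Xs ⟩
    length Xs                                   ≡⟨ ∣Xs∣≡s+2 ⟩
    s + 2                                       ∎)
    where open ≤-Reasoning

  starSets-intersecting : ∀ {P B} → W ⊆ P → B ∈ᶠ starSets → Intersecting P B
  starSets-intersecting W0⊆P B∈ with z , _ , refl ← ∈starSets⁻ B∈ = ⊆⇒intersecting ∣W∣≡t W0⊆P (p⊆⁅x⁆∪p z W)

  petals-almost : All (λ X → numTDisjoint t X G₀ ≤ s) petals
  petals-almost = All.tabulate λ A∈ → let i , i<k , A≡ = ∈petals⁻ A∈ in subst (λ A → numTDisjoint t A G₀ ≤ s) (sym A≡) (begin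
    numTDisjoint t (petal i) (starSets ++ links)                               ≡⟨ cong length (filter-++ (disjoint? (petal i)) starSets links) ⟩
    length (filter (disjoint? (petal i)) starSets ++ filter (disjoint? (petal i)) links) ≡⟨ length-++ (filter (disjoint? (petal i)) starSets) ⟩
    length (filter (disjoint? (petal i)) starSets) + numTDisjoint t (petal i) links ≡⟨ cong (λ xs → length xs + numTDisjoint t (petal i) links)
                                                                       (filter-none (disjoint? (petal i)) (All.tabulate (λ B∈ → ≤⇒≯ (starSets-intersecting (p⊆⁅x⁆∪p (x i) W) B∈)))) ⟩
    numTDisjoint t (petal i) links                                      ≤⟨ numDisjoint≤s (petal i) links length-links (link∈links i<k) (link∈links (prev<k i<k))
                                                                       (λ e → prev≢ i<k (sym (link-injective i<k (prev<k i<k) e)))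
                                                                       (petal∼link i<k i<k (inj₁ refl)) (petal∼link i<k (prev<k i<k) (inj₂ (sym (next∘prev i<k)))) ⟩
    s                                                            ∎)
    where open ≤-Reasoning

  G₀-almost : All (λ X → numTDisjoint t X petals ≤ s) G₀
  G₀-almost = All.tabulate λ B∈ → case (∈-++⁻ starSets B∈)
    where
    case : ∀ {B} → B ∈ᶠ starSets ⊎ B ∈ᶠ links → numTDisjoint t B petals ≤ s
    case {B} (inj₁ B∈S) = subst (_≤ s) (sym (cong length (filter-none (disjoint? B)
      (All.tabulate (λ A∈ → let i , _ , A≡ = ∈petals⁻ A∈ in
        ≤⇒≯ (intersecting-sym _ B (starSets-intersecting (subst (W ⊆_) (sym A≡) (p⊆⁅x⁆∪p (x i) W)) B∈S))))))) z≤n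
    case (inj₂ B∈D0) with j , j<k , refl ← ∈links⁻ B∈D0 =
      numDisjoint≤s (link j) petals length-petals (petal∈petals j<k) (petal∈petals (next<k j<k)) (λ e → next≢ j<k (sym (petal-injective j<k (next<k j<k) e)))
        (intersecting-sym (petal j) (link j) (petal∼link j<k j<k (inj₁ refl))) (intersecting-sym (petal (next j)) (link j) (petal∼link (next<k j<k) j<k (inj₂ refl)))

  admissible : Admissible n t s petals G₀
  admissible = (petals-unique , petals-sizes) , (G₀-unique , G₀-sizes) , (petals-almost , G₀-almost) , ncross ,
    subst₂ _≤_ (sym length-petals) (sym (trans (length-++ starSets) (cong₂ _+_ length-starSets length-links))) (m≤n+m k (n ∸ t))
    where
    h0 : 0 < k
    h0 = ≤-trans (s≤s z≤n) k≥3
    h1 : 1 < k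
    h1 = ≤-trans (s≤s (s≤s z≤n)) k≥3
    ncross : ¬ CrossTIntersecting t petals G₀
    ncross c = <⇒≱ (petal≁link h0 h1 (λ ()) (λ e → 0≢1+n (trans e (next-suc k≥3))))
      (all-lookup (all-lookup c (petal∈petals h0)) (∈-++⁺ʳ starSets (link∈links h1)))

  product≡L₂ : length petals * length G₀ ≡ L₂ n t s
  product≡L₂ = cong₂ _*_ length-petals (trans (length-++ starSets) (cong₂ _+_ length-starSets length-links))

module MainArgument (n t s : ℕ) (t≥1 : 1 ≤ t) (s≥1 : 1 ≤ s) (big : 5 * s * (t + 1) ^ 2 ≤ n) where

  open AlmostCrossIntersecting n t s
  open Classification n t s t≥1 s≥1 big
  open Maximality n t s

  module _ {F G : Family n} (adm : Admissible n t s F G) (maximal : Maximal F G) where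

    L₁≤product : L₁ n t s ≤ length F * length G
    L₁≤product = ≤-trans (≤-reflexive (sym product≡L₁)) (maximal _ _ admissible)
      where open ConfigurationI n t s t≥1 s≥1 (t+[s+2]≤n t s t≥1 s≥1 big)

    L₂≤product : L₂ n t s ≤ length F * length G
    L₂≤product = ≤-trans (≤-reflexive (sym product≡L₂)) (maximal _ _ admissible)
      where open ConfigurationII n t s t≥1 s≥1 (t+[s+2]≤n t s t≥1 s≥1 big)

  part-i : ∀ {F G} → Admissible n t s F G → Maximal F G → s + 2 ≤ t → Conclusion-i F G
  part-i {[]} adm _ _ = ⊥-elim (Unpack.not-cross adm [])
  part-i {_ ∷ []} {G} adm maximal _ = singleton-structure adm maximal (subst (L₁ n t s ≤_) (+-identityʳ (length G)) (L₁≤product adm maximal))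
  part-i {F@(_ ∷ _ ∷ _)} {G} adm maximal s+2≤t = ⊥-elim (<-irrefl refl (begin-strict
    length F * length G  ≤⟨ [ <⇒≤ , star-product≤L₂ adm ]′ (product<L₂⊎star adm (s≤s (s≤s z≤n))) ⟩
    L₂ n t s             <⟨ L₂<L₁ n t s t≥1 s≥1 big s+2≤t ⟩
    L₁ n t s             ≤⟨ L₁≤product adm maximal ⟩
    length F * length G  ∎))
    where open ≤-Reasoning

  part-ii : ∀ {F G} → Admissible n t s F G → Maximal F G → t ≤ s + 1 → Conclusion-ii F G
  part-ii {[]} adm _ _ = ⊥-elim (Unpack.not-cross adm [])
  part-ii {F@(_ ∷ [])} {G} adm maximal t≤s+1 = ⊥-elim (<-irrefl refl (begin-strict
    length F * length G  ≡⟨ +-identityʳ (length G) ⟩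
    length G             ≤⟨ singleton-length≤L₁ adm ⟩
    L₁ n t s             <⟨ L₁<L₂ n t s t≥1 s≥1 big t≤s+1 ⟩
    L₂ n t s             ≤⟨ L₂≤product adm maximal ⟩
    length F * length G  ∎))
    where open ≤-Reasoning
  part-ii {_ ∷ _ ∷ _} adm maximal _ =
    [ (λ product<L₂ → ⊥-elim (≤⇒≯ (L₂≤product adm maximal) product<L₂))
    , (λ configuration → StarStructure.conclusion adm maximal configuration (L₂≤product adm maximal))
    ]′ (product<L₂⊎star adm (s≤s (s≤s z≤n)))

theorem1p3 : (n t s : ℕ) → 1 ≤ n → 1 ≤ t → 1 ≤ s →
    5 * s * (t + 1) ^ 2 ≤ n →
    (𝓕 𝓖 : Family n) →
    Admissible n t s 𝓕 𝓖 →
    (∀ (𝓕′ 𝓖′ : Family n) → Admissible n t s 𝓕′ 𝓖′ →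
      length 𝓕′ * length 𝓖′ ≤ length 𝓕 * length 𝓖) →
    ((s + 2 ≤ t →
      ∃[ Y ] (∣ Y ∣ ≡ t + 1 ×
        (∀ X → (X ∈ᶠ 𝓕) ⇔ (X ≡ Y)) ×
        ∃[ 𝓒 ] (Unique 𝓒 × length 𝓒 ≡ s ×
          All (λ X → ∣ X ∣ ≡ t + 1 × ¬ M₁ Y (t + 1) t X) 𝓒 ×
          (∀ X → (X ∈ᶠ 𝓖) ⇔ (M₁ Y (t + 1) t X ⊎ X ∈ᶠ 𝓒)))))
    ×
     (t ≤ s + 1 →
      ∃[ Z ] ∃[ W ] (∣ Z ∣ ≡ t + s + 2 × W ⊆ Z × ∣ W ∣ ≡ t ×
        (∀ X → (X ∈ᶠ 𝓕) ⇔ H₁ Z W (t + 1) X) ×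
        ∃[ 𝓓 ] (Unique 𝓓 × length 𝓓 ≡ s + 2 ×
          All (M₂ Z W t) 𝓓 ×
          (∀ i → i ∈ Z → i ∉ W → numContaining i 𝓓 ≡ 2) ×
          (∀ X → (X ∈ᶠ 𝓖) ⇔ (H₁ ⊤ W (t + 1) X ⊎ X ∈ᶠ 𝓓))))))
theorem1p3 n t s _ t≥1 s≥1 big 𝓕 𝓖 adm maximal = part-i adm maximal , part-ii adm maximal
  where open MainArgument n t s t≥1 s≥1 big
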